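{- Let $n>0$ and $\sigma\in C_{2n}(123)$. The number of right connected components of $\sigma$ equals $2\cdot\mathrm{ret}(\Phi(\sigma))$ if $\Phi(\sigma)$ is a Dyck path, and $2\cdot\mathrm{ret}(\Phi(\sigma))+1$ otherwise.
   Context: $C_{2n}(123)$ is the set of permutations $\sigma$ of $[2n]=\{1,\dots,2n\}$ with $\sigma(i)+\sigma(2n+1-i)=2n+1$ for all $i$ and no $i<j<k$ with $\sigma(i)<\sigma(j)<\sigma(k)$. The connected components of a permutation $\tau$ of $[m]$ are the restrictions of $\tau$ to the blocks of the finest partition of $[m]$ into intervals $I$ with $\tau(I)=I$; the number of right connected components of $\sigma$ is the number of connected components of $\sigma^{rev}$, where $\sigma^{rev}(i)=\sigma(2n+1-i)$. A Dyck prefix of length $m$ is a word in $U=(1,1)$, $D=(1,-1)$ of length $m$ whose lattice path from the origin never goes below the $x$-axis; it is a Dyck path if it ends on the $x$-axis; $\mathrm{ret}(\pi)$ is the number of down steps of $\pi$ ending on the $x$-axis. For a set $S=\{s_1<\dots<s_r\}$ and a permutation $\tau$ of $[r]$, the word on $S$ order-isomorphic to $\tau$ is $s_{\tau(1)}\cdots s_{\tau(r)}$. Define $\Psi$ recursively from Dyck prefixes of length $2n$ to permutations of $[2n]$: the empty prefix goes to the empty permutation; for nonempty $\pi=U^jD^k\pi'$ ($j\ge1,k\ge0$ maximal), $\sigma=\Psi(\pi)$ is: (a) if $j\le n$: $\sigma(1)=2n+1-j$, $\sigma(i)=2n+2-i$ ($2\le i\le k$), $\sigma(2n)=j$, $\sigma(2n-i)=i$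 ($1\le i\le k-1$), and $\sigma(k+1)\cdots\sigma(2n-k)$ is the word on $[2n]\setminus\{1,\dots,k-1,j,2n+1-j,2n-k+2,\dots,2n\}$ order-isomorphic to $\Psi(U^{j-k}\pi')$; (b) if $j=n+1$: $\sigma(1)=n$, $\sigma(i)=2n+2-i$ ($2\le i\le k+1$), $\sigma(2n)=n+1$, $\sigma(2n-i)=i$ ($1\le i\le k$), and $\sigma(k+2)\cdots\sigma(2n-k-1)$ is the word on $[2n]\setminus\{1,\dots,k,n,n+1,2n-k+1,\dots,2n\}$ order-isomorphic to $\Psi(U^{n-k-1}\pi')$; (c) if $j\ge n+2$: $\sigma(1)=n$, $\sigma(2n)=n+1$, and $\sigma(2)\cdots\sigma(2n-1)$ is the word on $[2n]\setminus\{n,n+1\}$ order-isomorphic to $\Psi(U^{j-2}D^k\pi')$. The paper shows $\Psi$ is a bijection onto $C_{2n}(123)$; $\Phi$ denotes its inverse. -}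

module Defs where

open import Data.Nat using (ℕ; zero; suc; _+_; _*_; _∸_; _≤_; _<_; _≤ᵇ_; _≡ᵇ_)
open import Data.Nat.Base using (⌊_/2⌋)
open import Data.Bool using (Bool; true; false; if_then_else_; not; _∨_)
open import Data.Bool.ListAction using (and)
open import Data.List using (List; []; _∷_; _++_; map; filterᵇ; length; replicate; reverse; upTo; take)
open import Data.List.Relation.Binary.Permutation.Propositional using (_↭_)
open import Data.Product using (_×_; _,_; Σ)
open import Data.Empty using (⊥)
open import Relation.Nullary using (¬_)
open import Relation.Binary.PropositionalEquality using (_≡_)

data Step : Set where
  U D : Step

-- DP h π e : the path π, started at height h, never goes below the
-- x-axis and ends at height e.
data DP : ℕ → List Step → ℕ → Set where
  done : ∀ {h} → DP h [] h
  up   : ∀ {h s e} → DP (suc h) s e → DP h (U ∷ s) e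
  down : ∀ {h s e} → DP h s e → DP (suc h) (D ∷ s) e

DyckPrefix : List Step → Set
DyckPrefix π = Σ ℕ λ e → DP 0 π e

DyckPath : List Step → Set
DyckPath π = DP 0 π 0

retFrom : ℕ → List Step → ℕ
retFrom h [] = 0
retFrom h (U ∷ s) = retFrom (suc h) s
retFrom zero (D ∷ s) = retFrom zero s          -- never happens for prefixes
retFrom (suc zero) (D ∷ s) = suc (retFrom zero s)
retFrom (suc (suc h)) (D ∷ s) = retFrom (suc h) s

ret : List Step → ℕ
ret = retFrom 0

-- Permutations as words (one-line notation, values 1..m)

range1 : ℕ → List ℕ
range1 m = map suc (upTo m)

-- 0-indexed lookup with default 0
nth : List ℕ → ℕ → ℕ
nth [] _ = 0
nth (x ∷ xs) zero = x
nth (x ∷ xs) (suc i) = nth xs i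

IsPerm : ℕ → List ℕ → Set
IsPerm m σ = σ ↭ range1 m

-- σ(i) + σ(2n+1-i) = 2n+1, written 0-indexed
Symmetric : ℕ → List ℕ → Set
Symmetric m σ = ∀ i → i < m → nth σ i + nth σ (m ∸ suc i) ≡ suc m

Avoids123 : List ℕ → Set
Avoids123 σ = ∀ i j k → i < j → j < k → k < length σ →
  ¬ (nth σ i < nth σ j × nth σ j < nth σ k)

InC123 : ℕ → List ℕ → Set
InC123 m σ = IsPerm m σ × Symmetric m σ × Avoids123 σ

-- Number of connected components of a permutation τ of [m]: the blocks
-- of the finest interval partition with τ(I) = I end exactly at those
-- m' ∈ [1,m] with τ({1..m'}) = {1..m'}, i.e. τ(i) ≤ m' for all i ≤ m'.
components : List ℕ → ℕ
components τ =
  length (filterᵇ (λ m' → and (map (λ v → v ≤ᵇ m') (take m' τ))) (range1 (length τ)))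

rightComponents : List ℕ → ℕ
rightComponents σ = components (reverse σ)

leadU : List Step → ℕ × List Step
leadU (U ∷ s) with leadU s
... | (j , r) = (suc j , r)
leadU s = (0 , s)

leadD : List Step → ℕ × List Step
leadD (D ∷ s) with leadD s
... | (k , r) = (suc k , r)
leadD s = (0 , s)

-- word on S (increasing list) order-isomorphic to τ (values 1..r)
embed : List ℕ → List ℕ → List ℕ
embed S τ = map (λ v → nth S (v ∸ 1)) τ

complementIn : ℕ → (ℕ → Bool) → List ℕ
complementIn m removed = filterᵇ (λ v → not (removed v)) (range1 m)

-- Ψ with fuel; each recursive call shortens the prefix by at least 2,
-- so fuel = length of the prefix suffices (see Ψ below).
psi : ℕ → List Step → List ℕ
psi zero _ = []
psi (suc f) [] = []
psi (suc f) π@(_ ∷ _) with leadU π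
... | (j , r) with leadD r
... | (k , π') =
  if j ≤ᵇ n then caseA
  else if j ≡ᵇ suc n then caseB
  else caseC
  where
    n : ℕ
    n = ⌊ length π /2⌋
    m : ℕ
    m = 2 * n
    caseA : List ℕ
    caseA =
      (suc m ∸ j)
      ∷ map (λ i → (m + 2) ∸ i) (map (2 +_) (upTo (k ∸ 1)))
      ++ embed (complementIn m (λ v → (v ≤ᵇ (k ∸ 1)) ∨ (v ≡ᵇ j) ∨ (v ≡ᵇ (suc m ∸ j))
                                        ∨ (((m + 2) ∸ k) ≤ᵇ v)))
               (psi f (replicate (j ∸ k) U ++ π'))
      ++ reverse (range1 (k ∸ 1))
      ++ j ∷ []
    caseB : List ℕ
    caseB =
      n
      ∷ map (λ i → (m + 2) ∸ i) (map (2 +_) (upTo k))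
      ++ embed (complementIn m (λ v → (v ≤ᵇ k) ∨ (v ≡ᵇ n) ∨ (v ≡ᵇ suc n)
                                        ∨ ((suc m ∸ k) ≤ᵇ v)))
               (psi f (replicate (n ∸ k ∸ 1) U ++ π'))
      ++ reverse (range1 k)
      ++ suc n ∷ []
    caseC : List ℕ
    caseC =
      n
      ∷ embed (complementIn m (λ v → (v ≡ᵇ n) ∨ (v ≡ᵇ suc n)))
              (psi f (replicate (j ∸ 2) U ++ replicate k D ++ π'))
      ++ suc n ∷ []

Ψ : List Step → List ℕ
Ψ π = psi (length π) π

{-# OPTIONS --safe #-}
-- Read σ = Ψ π backwards: τ = reverse σ.  A right component of σ ends at position m of τ
-- exactly when the first m entries of τ are at most m (a cut of τ), so we count cuts.
-- In each case of Ψ, τ is a frame: an entry h, the values 1 … c, the increasing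
-- relabelling g(w) of w = reverse (Ψ π'') for the recursive prefix π'', the block of the
-- c largest values, and a last entry z; the end of τ is always a cut.  In cases (b) and
-- (c) it is the only one, while π never returns to the axis and ends above it.  In case
-- (a), if the first descent of π returns to the axis, the end of the front block is a
-- cut and the cuts inside g(w) are those of w, giving two cuts for the one extra return;
-- otherwise the last cut of w is lost and nothing else changes.  Matching cuts of g(w)
-- with cuts of w needs the invariant that a proper cut m of w satisfies m + w₁ ≤ |w|.
-- Induction along the recursion gives cuts τ = 2 ret π + [π ends above the axis].
module Submission where

open import Defs
open import Data.Bool using (Bool; true; false; T; not; _∧_; _∨_; if_then_else_)
open import Data.Bool.Properties using (T-∧; T-∨)
open import Data.Bool.ListAction using (and)
open import Data.Empty using (⊥-elim)
open import Data.List using (List; []; _∷_; _++_; map; filterᵇ; length; take; foldr; applyUpTo; replicate; reverse; upTo)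
open import Data.List.Properties using (filter-++; filter-all; filter-none; length-++; length-map; length-replicate)
open import Data.List.Properties using (take-map; take-all; map-applyUpTo; reverse-map; reverse-++; unfold-reverse)
open import Data.List.Properties using (reverse-involutive; ++-assoc; ++-identityʳ)
open import Data.List.Relation.Unary.All as All using (All; []; _∷_)
open import Data.List.Relation.Unary.All.Properties using (++⁺; map⁺; take⁺)
open import Data.Nat
open import Data.Nat.Properties
open import Data.Nat.Tactic.RingSolver using (solve-∀)
open import Data.Product using (∃-syntax; _×_; _,_; proj₁; proj₂)
open import Data.Sum using (_⊎_; inj₁; inj₂; [_,_]′)
open import Function using (_∘_; Equivalence)
open import Relation.Binary using (_Preserves_⟶_)
open import Relation.Binary.PropositionalEquality
open import Relation.Nullary using (¬_; T?; yes; no)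

T-injective : ∀ {x y} → (T x → T y) → (T y → T x) → x ≡ y
T-injective {false} {false} _ _ = refl
T-injective {false} {true}  _ g = ⊥-elim (g _)
T-injective {true}  {false} f _ = ⊥-elim (f _)
T-injective {true}  {true}  _ _ = refl

T-∨ˡ : ∀ {x} y → T x → T (x ∨ y)
T-∨ˡ y t = Equivalence.from T-∨ (inj₁ t)

T-∨ʳ : ∀ x {y} → T y → T (x ∨ y)
T-∨ʳ x t = Equivalence.from T-∨ (inj₂ t)

¬T-∨ : ∀ {x y} → ¬ T x → ¬ T y → ¬ T (x ∨ y)
¬T-∨ ¬x ¬y t = [ ¬x , ¬y ]′ (Equivalence.to T-∨ t)

¬T-≤ᵇ : ∀ {m n} → n < m → ¬ T (m ≤ᵇ n)
¬T-≤ᵇ {m} {n} n<m t = <⇒≱ n<m (≤ᵇ⇒≤ m n t)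

¬T-≡ᵇ : ∀ {m n} → m ≢ n → ¬ T (m ≡ᵇ n)
¬T-≡ᵇ {m} {n} m≢n t = m≢n (≡ᵇ⇒≡ m n t)

m+d≡n⇒m≤n : ∀ {m n} d → m + d ≡ n → m ≤ n
m+d≡n⇒m≤n {m} d refl = m≤m+n m d

≤-or-beyond : ∀ m a → m ≤ a ⊎ ∃[ m' ] (1 ≤ m' × m ≡ a + m')
≤-or-beyond m a with m ≤? a
... | yes m≤a = inj₁ m≤a
... | no  m≰a = inj₂ (m ∸ a , m<n⇒0<n∸m (≰⇒> m≰a) , sym (m+[n∸m]≡n (<⇒≤ (≰⇒> m≰a))))

<-or-offset : ∀ u a → u < a ⊎ ∃[ u' ] u ≡ a + u'
<-or-offset u a with u <? a
... | yes u<a = inj₁ u<a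
... | no  u≮a = inj₂ (u ∸ a , sym (m+[n∸m]≡n (≮⇒≥ u≮a)))

interval : ℕ → ℕ → List ℕ
interval a zero    = []
interval a (suc b) = suc a ∷ interval (suc a) b

length-interval : ∀ a b → length (interval a b) ≡ b
length-interval a zero    = refl
length-interval a (suc b) = cong suc (length-interval (suc a) b)

interval-++ : ∀ a b c → interval a (b + c) ≡ interval a b ++ interval (a + b) c
interval-++ a zero    c = cong (λ x → interval x c) (sym (+-identityʳ a))
interval-++ a (suc b) c =
  cong (suc a ∷_) (trans (interval-++ (suc a) b c) (cong (λ x → interval (suc a) b ++ interval x c) (sym (+-suc a b))))

applyUpTo≡interval : ∀ a c (f : ℕ → ℕ) → (∀ i → f i ≡ suc (a + i)) → applyUpTo f c ≡ interval a c
applyUpTo≡interval a zero    f hf = refl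
applyUpTo≡interval a (suc c) f hf =
  cong₂ _∷_ (trans (hf 0) (cong suc (+-identityʳ a)))
            (applyUpTo≡interval (suc a) c (f ∘ suc) (λ i → trans (hf (suc i)) (cong suc (+-suc a i))))

range1≡interval : ∀ m → range1 m ≡ interval 0 m
range1≡interval m = trans (map-applyUpTo (λ i → i) suc m) (applyUpTo≡interval 0 m suc (λ _ → refl))

All-interval : ∀ a b → All (λ v → a < v × v ≤ a + b) (interval a b)
All-interval a zero    = []
All-interval a (suc b) =
  (≤-refl , subst (suc a ≤_) (sym (+-suc a b)) (s≤s (m≤m+n a b)))
  ∷ All.map (λ {v} (lo , hi) → <⇒≤ lo , subst (v ≤_) (sym (+-suc a b)) hi) (All-interval (suc a) b)

take-interval : ∀ a b i → i ≤ b → take i (interval a b) ≡ interval a i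
take-interval a b       zero    _         = refl
take-interval a (suc b) (suc i) (s≤s i≤b) = cong (suc a ∷_) (take-interval (suc a) b i i≤b)

nth-interval : ∀ a b i → i < b → nth (interval a b) i ≡ suc (a + i)
nth-interval a (suc b) zero    _         = cong suc (sym (+-identityʳ a))
nth-interval a (suc b) (suc i) (s≤s i<b) = trans (nth-interval (suc a) b i i<b) (cong suc (sym (+-suc a i)))

count : (ℕ → Bool) → ℕ → ℕ → ℕ
count p a b = length (filterᵇ p (interval a b))

count-++ : ∀ p a b c → count p a (b + c) ≡ count p a b + count p (a + b) c
count-++ p a b c = begin
  length (filterᵇ p (interval a (b + c)))
    ≡⟨ cong (length ∘ filterᵇ p) (interval-++ a b c) ⟩
  length (filterᵇ p (interval a b ++ interval (a + b) c))
    ≡⟨ cong length (filter-++ (T? ∘ p) (interval a b) (interval (a + b) c)) ⟩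
  length (filterᵇ p (interval a b) ++ filterᵇ p (interval (a + b) c))
    ≡⟨ length-++ (filterᵇ p (interval a b)) ⟩
  count p a b + count p (a + b) c ∎
  where open ≡-Reasoning

count-shift : ∀ p a b → count p a b ≡ count (λ v → p (a + v)) 0 b
count-shift p a b = trans (cong (λ x → count p x b) (sym (+-identityʳ a))) (shifted 0 b)
  where
  shifted : ∀ c b → count p (a + c) b ≡ count (λ v → p (a + v)) c b
  shifted c zero = refl
  shifted c (suc b) rewrite sym (+-suc a c) with p (a + suc c)
  ... | true  = cong suc (shifted (suc c) b)
  ... | false = shifted (suc c) b

count-cong : ∀ {p q} a b → (∀ v → a < v → v ≤ a + b → p v ≡ q v) → count p a b ≡ count q a b
count-cong {p} {q} a b same = cong length (filterᵇ-cong (All.map (λ (lo , hi) → same _ lo hi) (All-interval a b)))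
  where
  filterᵇ-cong : ∀ {xs} → All (λ v → p v ≡ q v) xs → filterᵇ p xs ≡ filterᵇ q xs
  filterᵇ-cong [] = refl
  filterᵇ-cong {x ∷ _} (e ∷ es) with p x | q x | e
  ... | true  | .true  | refl = cong (x ∷_) (filterᵇ-cong es)
  ... | false | .false | refl = filterᵇ-cong es

count-none : ∀ p a b → (∀ v → a < v → v ≤ a + b → ¬ T (p v)) → count p a b ≡ 0
count-none p a b none = cong length (filter-none (T? ∘ p) (All.map (λ (lo , hi) → none _ lo hi) (All-interval a b)))

count-single : ∀ p a → T (p (suc a)) → count p a 1 ≡ 1
count-single p a t with p (suc a)
... | true = refl

count-snoc : ∀ p b → count p 0 (suc b) ≡ count p 0 b + count p b 1
count-snoc p b = trans (cong (count p 0) (+-comm 1 b)) (count-++ p 0 b 1)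

-- Prefix maxima and cuts

maximum : List ℕ → ℕ
maximum = foldr _⊔_ 0

maximum-++ : ∀ xs ys → maximum (xs ++ ys) ≡ maximum xs ⊔ maximum ys
maximum-++ []       ys = refl
maximum-++ (x ∷ xs) ys = trans (cong (x ⊔_) (maximum-++ xs ys)) (sym (⊔-assoc x (maximum xs) (maximum ys)))

maximum-map : ∀ {g} → g Preserves _≤_ ⟶ _≤_ → ∀ x xs → maximum (map g (x ∷ xs)) ≡ g (maximum (x ∷ xs))
maximum-map {g} mono x []       = trans (⊔-identityʳ (g x)) (cong g (sym (⊔-identityʳ x)))
maximum-map {g} mono x (y ∷ xs) =
  trans (cong (g x ⊔_) (maximum-map mono y xs)) (sym (mono-≤-distrib-⊔ mono x (maximum (y ∷ xs))))

maximum-map⁺ : ∀ {g} → g Preserves _≤_ ⟶ _≤_ → ∀ w → 1 ≤ length w → maximum (map g w) ≡ g (maximum w)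
maximum-map⁺ mono (x ∷ w) _ = maximum-map mono x w

maximum-interval : ∀ a b → maximum (interval a (suc b)) ≡ a + suc b
maximum-interval a zero    = trans (⊔-identityʳ (suc a)) (sym (+-comm a 1))
maximum-interval a (suc b) =
  trans (cong (suc a ⊔_) (maximum-interval (suc a) b))
        (trans (m≤n⇒m⊔n≡n (m≤m+n (suc a) (suc b))) (sym (+-suc a (suc b))))

maximum-interval⁺ : ∀ a {b} → 1 ≤ b → maximum (interval a b) ≡ a + b
maximum-interval⁺ a {suc b} _ = maximum-interval a b

maximum-≤ : ∀ {L} xs → All (_≤ L) xs → maximum xs ≤ L
maximum-≤ []       []           = z≤n
maximum-≤ (x ∷ xs) (x≤L ∷ xs≤L) = ⊔-lub x≤L (maximum-≤ xs xs≤L)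

and-≤ᵇ : ∀ m xs → and (map (_≤ᵇ m) xs) ≡ (maximum xs ≤ᵇ m)
and-≤ᵇ m []       = refl
and-≤ᵇ m (x ∷ xs) = trans (cong ((x ≤ᵇ m) ∧_) (and-≤ᵇ m xs)) (T-injective both-≤ ⊔-≤)
  where
  both-≤ : T ((x ≤ᵇ m) ∧ (maximum xs ≤ᵇ m)) → T ((x ⊔ maximum xs) ≤ᵇ m)
  both-≤ t with Equivalence.to T-∧ t
  ... | tx , txs = ≤⇒≤ᵇ (⊔-lub (≤ᵇ⇒≤ x m tx) (≤ᵇ⇒≤ (maximum xs) m txs))
  ⊔-≤ : T ((x ⊔ maximum xs) ≤ᵇ m) → T ((x ≤ᵇ m) ∧ (maximum xs ≤ᵇ m))
  ⊔-≤ t = Equivalence.from T-∧ (≤⇒≤ᵇ (m⊔n≤o⇒m≤o x _ x⊔≤) , ≤⇒≤ᵇ (m⊔n≤o⇒n≤o x _ x⊔≤))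
    where x⊔≤ = ≤ᵇ⇒≤ (x ⊔ maximum xs) m t

prefixMax : List ℕ → ℕ → ℕ
prefixMax τ m = maximum (take m τ)

isCut : List ℕ → ℕ → Bool
isCut τ m = prefixMax τ m ≤ᵇ m

components≡count-isCut : ∀ τ → components τ ≡ count (isCut τ) 0 (length τ)
components≡count-isCut τ = trans (cong (λ l → length (filterᵇ andPrefix l)) (range1≡interval (length τ)))
  (count-cong 0 (length τ) (λ m _ _ → and-≤ᵇ m (take m τ)))
  where
  andPrefix : ℕ → Bool
  andPrefix m = and (map (_≤ᵇ m) (take m τ))

prefixMax-mono : ∀ τ {m m'} → m ≤ m' → prefixMax τ m ≤ prefixMax τ m'
prefixMax-mono τ       {zero}           _           = z≤n
prefixMax-mono []      {suc m} {suc m'} _          = z≤n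
prefixMax-mono (x ∷ τ) {suc m} {suc m'} (s≤s m≤m') = ⊔-monoʳ-≤ x (prefixMax-mono τ m≤m')

prefixMax-length : ∀ τ → prefixMax τ (length τ) ≡ maximum τ
prefixMax-length τ = cong maximum (take-all (length τ) τ ≤-refl)

prefixMax-++ˡ : ∀ X Y {m} → m ≤ length X → prefixMax (X ++ Y) m ≡ prefixMax X m
prefixMax-++ˡ X Y {m} m≤ = cong maximum (take-++ˡ X m≤)
  where
  take-++ˡ : ∀ X {m} → m ≤ length X → take m (X ++ Y) ≡ take m X
  take-++ˡ X       {zero}  _         = refl
  take-++ˡ (x ∷ X) {suc m} (s≤s m≤) = cong (x ∷_) (take-++ˡ X m≤)

prefixMax-++ʳ : ∀ X Y i → prefixMax (X ++ Y) (length X + i) ≡ maximum X ⊔ prefixMax Y i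
prefixMax-++ʳ X Y i = trans (cong maximum (take-++ʳ X)) (maximum-++ X (take i Y))
  where
  take-++ʳ : ∀ X → take (length X + i) (X ++ Y) ≡ X ++ take i Y
  take-++ʳ []      = refl
  take-++ʳ (x ∷ X) = cong (x ∷_) (take-++ʳ X)

prefixMax-map : ∀ {g} → g Preserves _≤_ ⟶ _≤_ → ∀ w {m} → 1 ≤ m → m ≤ length w →
                prefixMax (map g w) m ≡ g (prefixMax w m)
prefixMax-map mono (x ∷ w) {suc m} _ _ = trans (cong maximum (take-map (suc m) (x ∷ w))) (maximum-map mono x (take m w))

prefixMax-interval : ∀ a b {i} → 1 ≤ i → i ≤ b → prefixMax (interval a b) i ≡ a + i
prefixMax-interval a b {suc i} _ i≤b = trans (cong maximum (take-interval a b (suc i) i≤b)) (maximum-interval a i)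

-- What the recursion preserves about τ = reverse (Ψ π), where L = |π|.
record CutInvariant (L : ℕ) (τ : List ℕ) : Set where
  field
    length≡    : length τ ≡ L
    bounded    : All (λ v → 1 ≤ v × v ≤ L) τ
    ≤prefixMax : ∀ m → 1 ≤ m → m ≤ L → m ≤ prefixMax τ m
    cut+head≤  : ∀ m → 1 ≤ m → m < L → prefixMax τ m ≤ m → m + prefixMax τ 1 ≤ L

  prefixMax≤ : ∀ m → prefixMax τ m ≤ L
  prefixMax≤ m = maximum-≤ (take m τ) (take⁺ m (All.map (λ (_ , v≤L) → v≤L) bounded))

  prefixMax-L : 1 ≤ L → prefixMax τ L ≡ L
  prefixMax-L 1≤L = ≤-antisym (prefixMax≤ L) (≤prefixMax L 1≤L ≤-refl)

  maximum≡L : 1 ≤ L → maximum τ ≡ L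
  maximum≡L 1≤L = trans (sym (prefixMax-length τ)) (trans (cong (prefixMax τ) length≡) (prefixMax-L 1≤L))

  maximum≤ : maximum τ ≤ L
  maximum≤ = maximum-≤ τ (All.map (λ (_ , v≤L) → v≤L) bounded)

  isCut-L : T (isCut τ L)
  isCut-L = ≤⇒≤ᵇ (prefixMax≤ L)

-- The shape of reverse (Ψ π) in each of the three cases, with l = |w|.
frame : ℕ → ℕ → (ℕ → ℕ) → List ℕ → ℕ → ℕ → List ℕ
frame h c g w l z = h ∷ interval 0 c ++ map g w ++ interval (suc (suc c + l)) c ++ z ∷ []

module Frame (h c : ℕ) (g : ℕ → ℕ) (w : List ℕ) (l z : ℕ)
             (length-w : length w ≡ l) (g-mono : g Preserves _≤_ ⟶ _≤_) (c<h : c < h) where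

  τ : List ℕ
  τ = frame h c g w l z

  L : ℕ
  L = suc c + (l + suc c)

  private
    front back : List ℕ
    front = h ∷ interval 0 c
    back  = interval (suc (suc c + l)) c ++ z ∷ []

    length-map-w : length (map g w) ≡ l
    length-map-w = trans (length-map g w) length-w

  length-τ : length τ ≡ L
  length-τ = cong suc (begin
    length (interval 0 c ++ map g w ++ back)
      ≡⟨ length-++ (interval 0 c) ⟩
    length (interval 0 c) + length (map g w ++ back)
      ≡⟨ cong₂ _+_ (length-interval 0 c) (length-++ (map g w)) ⟩
    c + (length (map g w) + length back)
      ≡⟨ cong (λ x → c + (length (map g w) + x)) (length-++ (interval _ c)) ⟩
    c + (length (map g w) + (length (interval _ c) + 1))
      ≡⟨ cong₂ (λ x y → c + (x + (y + 1))) length-map-w (length-interval _ c) ⟩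
    c + (l + (c + 1))
      ≡⟨ cong (λ x → c + (l + x)) (+-comm c 1) ⟩
    c + (l + suc c) ∎)
    where open ≡-Reasoning

  prefixMax-1 : prefixMax τ 1 ≡ h
  prefixMax-1 = ⊔-identityʳ h

  private
    prefixMax-front-list : ∀ m → m ≤ c → prefixMax front (suc m) ≡ h
    prefixMax-front-list zero    _   = ⊔-identityʳ h
    prefixMax-front-list (suc m) m<c =
      trans (cong (h ⊔_) (prefixMax-interval 0 c (s≤s z≤n) m<c)) (m≥n⇒m⊔n≡m (<⇒≤ (≤-<-trans m<c c<h)))

    maximum-front : maximum front ≡ h
    maximum-front = trans (sym (prefixMax-length front))
      (trans (cong (λ x → prefixMax front (suc x)) (length-interval 0 c)) (prefixMax-front-list c ≤-refl))

  prefixMax-front : ∀ {m} → 1 ≤ m → m ≤ suc c → prefixMax τ m ≡ h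
  prefixMax-front {suc m} _ (s≤s m≤c) =
    trans (prefixMax-++ˡ front _ (s≤s (subst (m ≤_) (sym (length-interval 0 c)) m≤c))) (prefixMax-front-list m m≤c)

  private
    prefixMax-after-front : ∀ m' → prefixMax τ (suc c + m') ≡ h ⊔ prefixMax (map g w ++ back) m'
    prefixMax-after-front m' =
      trans (cong (λ x → prefixMax τ (suc x + m')) (sym (length-interval 0 c)))
            (trans (prefixMax-++ʳ front _ m') (cong (_⊔ _) maximum-front))

  prefixMax-middle : ∀ {m'} → 1 ≤ m' → m' ≤ l → prefixMax τ (suc c + m') ≡ h ⊔ g (prefixMax w m')
  prefixMax-middle {m'} 1≤m' m'≤l = trans (prefixMax-after-front m') (cong (h ⊔_) (begin
    prefixMax (map g w ++ back) m' ≡⟨ prefixMax-++ˡ (map g w) back (subst (m' ≤_) (sym length-map-w) m'≤l) ⟩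
    prefixMax (map g w) m'         ≡⟨ prefixMax-map g-mono w 1≤m' (subst (m' ≤_) (sym length-w) m'≤l) ⟩
    g (prefixMax w m')             ∎))
    where open ≡-Reasoning

  prefixMax-back : ∀ {i} → 1 ≤ i → i ≤ c → suc c + l + i < prefixMax τ (suc c + l + i)
  prefixMax-back {i} 1≤i i≤c = subst (λ x → suc c + l + i < prefixMax τ x) (sym (+-assoc (suc c) l i))
    (subst (suc c + l + i <_) (sym (prefixMax-after-front (l + i)))
      (≤-trans (m≤n⊔m (maximum (map g w)) _) (≤-trans (≤-reflexive (sym backMax)) (m≤n⊔m h _))))
    where
    backMax : prefixMax (map g w ++ back) (l + i) ≡ maximum (map g w) ⊔ (suc (suc c + l) + i)
    backMax = begin
      prefixMax (map g w ++ back) (l + i)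
        ≡⟨ cong (λ x → prefixMax (map g w ++ back) (x + i)) (sym length-map-w) ⟩
      prefixMax (map g w ++ back) (length (map g w) + i)
        ≡⟨ prefixMax-++ʳ (map g w) back i ⟩
      maximum (map g w) ⊔ prefixMax back i
        ≡⟨ cong (maximum (map g w) ⊔_)
                (prefixMax-++ˡ (interval _ c) _ (subst (i ≤_) (sym (length-interval _ c)) i≤c)) ⟩
      maximum (map g w) ⊔ prefixMax (interval (suc (suc c + l)) c) i
        ≡⟨ cong (maximum (map g w) ⊔_) (prefixMax-interval _ c 1≤i i≤c) ⟩
      maximum (map g w) ⊔ (suc (suc c + l) + i) ∎
      where open ≡-Reasoning

  maximum-τ : maximum τ ≡ h ⊔ (maximum (map g w) ⊔ (maximum (interval (suc (suc c + l)) c) ⊔ (z ⊔ 0)))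
  maximum-τ = trans (maximum-++ front _) (cong₂ _⊔_ maximum-front
                (trans (maximum-++ (map g w) back) (cong (maximum (map g w) ⊔_) (maximum-++ (interval _ c) (z ∷ [])))))

  data Position (m : ℕ) : Set where
    in-front  : m ≤ suc c → Position m
    in-middle : ∀ {m'} → 1 ≤ m' → m' ≤ l → m ≡ suc c + m' → Position m
    in-back   : ∀ {i} → 1 ≤ i → i ≤ c → m ≡ suc c + l + i → Position m
    at-end    : m ≡ L → Position m

  position : ∀ m → m ≤ L → Position m
  position m m≤L with ≤-or-beyond m (suc c)
  ... | inj₁ m≤c = in-front m≤c
  ... | inj₂ (m' , 1≤m' , refl) with ≤-or-beyond m' l
  ... | inj₁ m'≤l = in-middle 1≤m' m'≤l refl
  ... | inj₂ (i , 1≤i , refl) with ≤-or-beyond i c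
  ... | inj₁ i≤c = in-back 1≤i i≤c (sym (+-assoc (suc c) l i))
  ... | inj₂ (t , 1≤t , refl) = at-end (≤-antisym m≤L
          (+-monoʳ-≤ (suc c) (+-monoʳ-≤ l (subst (_≤ c + t) (+-comm c 1) (+-monoʳ-≤ c 1≤t)))))

  middleCut : ℕ → Bool
  middleCut m' = (h ⊔ g (prefixMax w m')) ≤ᵇ (suc c + m')

  count-isCut : maximum τ ≤ L →
    count (isCut τ) 0 L ≡ count (h ≤ᵇ_) 0 (suc c) + count middleCut 0 l + 1
  count-isCut max≤L = begin
    count cut 0 (suc c + (l + suc c))
      ≡⟨ count-++ cut 0 (suc c) (l + suc c) ⟩
    count cut 0 (suc c) + count cut (suc c) (l + suc c)
      ≡⟨ cong (count cut 0 (suc c) +_) (count-++ cut (suc c) l (suc c)) ⟩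
    count cut 0 (suc c) + (count cut (suc c) l + count cut (suc c + l) (suc c))
      ≡⟨ cong₂ (λ x y → x + (y + count cut (suc c + l) (suc c))) frontCuts middleCuts ⟩
    count (h ≤ᵇ_) 0 (suc c) + (count middleCut 0 l + count cut (suc c + l) (suc c))
      ≡⟨ cong (λ x → count (h ≤ᵇ_) 0 (suc c) + (count middleCut 0 l + x)) backCuts ⟩
    count (h ≤ᵇ_) 0 (suc c) + (count middleCut 0 l + 1)
      ≡⟨ sym (+-assoc (count (h ≤ᵇ_) 0 (suc c)) _ 1) ⟩
    count (h ≤ᵇ_) 0 (suc c) + count middleCut 0 l + 1 ∎
    where
    open ≡-Reasoning
    cut = isCut τ
    frontCuts : count cut 0 (suc c) ≡ count (h ≤ᵇ_) 0 (suc c)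
    frontCuts = count-cong 0 (suc c) (λ m 1≤m m≤ → cong (_≤ᵇ m) (prefixMax-front 1≤m m≤))
    middleCuts : count cut (suc c) l ≡ count middleCut 0 l
    middleCuts = trans (count-shift cut (suc c) l)
      (count-cong 0 l (λ m' 1≤m' m'≤l → cong (_≤ᵇ (suc c + m')) (prefixMax-middle 1≤m' m'≤l)))
    backCuts : count cut (suc c + l) (suc c) ≡ 1
    backCuts = begin
      count cut (suc c + l) (suc c)
        ≡⟨ cong (count cut (suc c + l)) (+-comm 1 c) ⟩
      count cut (suc c + l) (c + 1)
        ≡⟨ count-++ cut (suc c + l) c 1 ⟩
      count cut (suc c + l) c + count cut (suc c + l + c) 1
        ≡⟨ cong₂ _+_ noBackCut (count-single cut (suc c + l + c) endCut) ⟩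
      1 ∎
      where
      noBackCut : count cut (suc c + l) c ≡ 0
      noBackCut = trans (count-shift cut (suc c + l) c) (count-none _ 0 c (λ i 1≤i i≤c t →
        <⇒≱ (prefixMax-back 1≤i i≤c) (≤ᵇ⇒≤ _ _ t)))
      L≡ : suc (suc c + l + c) ≡ L
      L≡ = trans (sym (+-suc (suc c + l) c)) (+-assoc (suc c) l (suc c))
      endCut : T (cut (suc (suc c + l + c)))
      endCut = ≤⇒≤ᵇ (subst (λ x → prefixMax τ x ≤ x) (trans length-τ (sym L≡))
        (subst (_≤ length τ) (sym (prefixMax-length τ)) (subst (maximum τ ≤_) (sym length-τ) max≤L)))

  ≤prefixMax-frame : (∀ m' → 1 ≤ m' → m' ≤ l → suc c + m' ≤ h ⊔ g (prefixMax w m')) → L ≤ maximum τ →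
                     ∀ m → 1 ≤ m → m ≤ L → m ≤ prefixMax τ m
  ≤prefixMax-frame middle≤ L≤max m 1≤m m≤L with position m m≤L
  ... | in-front m≤  = subst (m ≤_) (sym (prefixMax-front 1≤m m≤)) (≤-trans m≤ c<h)
  ... | in-middle {m'} 1≤m' m'≤l refl = subst (m ≤_) (sym (prefixMax-middle 1≤m' m'≤l)) (middle≤ m' 1≤m' m'≤l)
  ... | in-back 1≤i i≤c refl = <⇒≤ (prefixMax-back 1≤i i≤c)
  ... | at-end refl = subst (λ x → x ≤ prefixMax τ x) length-τ
                        (subst (length τ ≤_) (sym (prefixMax-length τ)) (subst (_≤ maximum τ) (sym length-τ) L≤max))

  cut+head-frame : (∀ m → 1 ≤ m → m ≤ suc c → h ≤ m → m + h ≤ L) →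
                   (∀ m' → 1 ≤ m' → m' ≤ l → h ⊔ g (prefixMax w m') ≤ suc c + m' → suc c + m' + h ≤ L) →
                   ∀ m → 1 ≤ m → m < L → prefixMax τ m ≤ m → m + prefixMax τ 1 ≤ L
  cut+head-frame frontCut middleCut m 1≤m m<L cut rewrite prefixMax-1 with position m (<⇒≤ m<L)
  ... | in-front m≤ = frontCut m 1≤m m≤ (subst (_≤ m) (prefixMax-front 1≤m m≤) cut)
  ... | in-middle 1≤m' m'≤l refl = middleCut _ 1≤m' m'≤l (subst (_≤ m) (prefixMax-middle 1≤m' m'≤l) cut)
  ... | in-back 1≤i i≤c refl = ⊥-elim (<⇒≱ (prefixMax-back 1≤i i≤c) cut)
  ... | at-end refl = ⊥-elim (<-irrefl refl m<L)

  bounded-frame : 1 ≤ h → h ≤ L → 1 ≤ z → z ≤ L → (∀ v → 1 ≤ v → v ≤ l → 1 ≤ g v × g v ≤ L) →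
                  All (λ v → 1 ≤ v × v ≤ l) w → All (λ v → 1 ≤ v × v ≤ L) τ
  bounded-frame 1≤h h≤L 1≤z z≤L g-bounded w-bounded = (1≤h , h≤L)
    ∷ ++⁺ (All.map (λ (lo , hi) → (lo , ≤-trans hi c≤L)) (All-interval 0 c))
      (++⁺ (map⁺ (All.map (λ (lo , hi) → g-bounded _ lo hi) w-bounded))
        (++⁺ (All.map (λ (lo , hi) → (≤-trans (s≤s z≤n) lo , ≤-trans hi backEnd≤L)) (All-interval _ c))
          ((1≤z , z≤L) ∷ [])))
    where
    c≤L : c ≤ L
    c≤L = ≤-trans (n≤1+n c) (m≤m+n (suc c) _)
    backEnd≤L : suc (suc c + l) + c ≤ L
    backEnd≤L = ≤-reflexive (arith c l)
      where
      arith : ∀ c l → suc (suc c + l) + c ≡ suc c + (l + suc c)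
      arith = solve-∀

  private
    MG MB : ℕ
    MG = maximum (map g w)
    MB = maximum (interval (suc (suc c + l)) c)

  h≤maximum : h ≤ maximum τ
  h≤maximum = subst (h ≤_) (sym maximum-τ) (m≤m⊔n h _)

  maximum-map≤maximum : MG ≤ maximum τ
  maximum-map≤maximum = subst (MG ≤_) (sym maximum-τ) (≤-trans (m≤m⊔n MG (MB ⊔ (z ⊔ 0))) (m≤n⊔m h _))

  maximum-back≤maximum : MB ≤ maximum τ
  maximum-back≤maximum = subst (MB ≤_) (sym maximum-τ)
    (≤-trans (m≤m⊔n MB (z ⊔ 0)) (≤-trans (m≤n⊔m MG _) (m≤n⊔m h _)))

  z≤maximum : z ≤ maximum τ
  z≤maximum = subst (z ≤_) (sym maximum-τ)
    (≤-trans (m≤m⊔n z 0) (≤-trans (m≤n⊔m MB _) (≤-trans (m≤n⊔m MG _) (m≤n⊔m h _))))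

jump : ℕ → ℕ → ℕ
jump t v = (v ∸ t) ⊓ 1

jump-≤ : ∀ {t v} → v ≤ t → jump t v ≡ 0
jump-≤ v≤t = cong (_⊓ 1) (m≤n⇒m∸n≡0 v≤t)

jump-> : ∀ {t v} → t < v → jump t v ≡ 1
jump-> t<v = m≥n⇒m⊓n≡n (m<n⇒0<n∸m t<v)

jump-mono : ∀ t → jump t Preserves _≤_ ⟶ _≤_
jump-mono t v≤v' = ⊓-monoˡ-≤ 1 (∸-monoˡ-≤ t v≤v')

jump≤1 : ∀ t v → jump t v ≤ 1
jump≤1 t v = m⊓n≤n (v ∸ t) 1

-- Counting cuts in cases (b) and (c)

-- The increasing enumeration of (k, k+r] ∪ (k+r+2, k+2r+2], the values that case (b)
-- leaves for the recursive image.
relabelB : ℕ → ℕ → ℕ → ℕ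
relabelB k r v = k + v + 2 * jump r v

relabelB-mono : ∀ k r → relabelB k r Preserves _≤_ ⟶ _≤_
relabelB-mono k r v≤v' = +-mono-≤ (+-monoʳ-≤ k v≤v') (*-monoʳ-≤ 2 (jump-mono r v≤v'))

relabelB-≤ : ∀ k r {v} → v ≤ r → relabelB k r v ≡ k + v
relabelB-≤ k r v≤r = trans (cong (λ x → k + _ + 2 * x) (jump-≤ v≤r)) (+-identityʳ _)

relabelB-> : ∀ k r {v} → r < v → relabelB k r v ≡ k + v + 2
relabelB-> k r r<v = cong (λ x → k + _ + 2 * x) (jump-> r<v)

relabelB≤ : ∀ k r v → relabelB k r v ≤ k + v + 2
relabelB≤ k r v = +-monoʳ-≤ (k + v) (*-monoʳ-≤ 2 (jump≤1 r v))

module CaseB (k r : ℕ) (w : List ℕ) (inv-w : CutInvariant (r + r) w) where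

  private
    module W = CutInvariant inv-w

  N : ℕ
  N = suc (k + r)

  private
    k<suc-N : k < suc N
    k<suc-N = s≤s (≤-trans (m≤m+n k r) (n≤1+n _))

  open Frame (suc N) k (relabelB k r) w (r + r) N W.length≡ (relabelB-mono k r) k<suc-N public

  L≡N+N : L ≡ N + N
  L≡N+N = arith k r
    where
    arith : ∀ k r → suc k + ((r + r) + suc k) ≡ suc (k + r) + suc (k + r)
    arith = solve-∀

  middle< : ∀ m' → 1 ≤ m' → m' ≤ r + r → suc k + m' < suc N ⊔ relabelB k r (prefixMax w m')
  middle< m' 1≤m' m'≤ with prefixMax w m' ≤? r
  ... | yes v≤r = ≤-trans (s≤s (s≤s (+-monoʳ-≤ k (≤-trans (W.≤prefixMax m' 1≤m' m'≤) v≤r))))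
                          (m≤m⊔n (suc N) (relabelB k r (prefixMax w m')))
  ... | no  v≰r = ≤-trans (≤-trans (≤-reflexive (sym (+-comm (k + m') 2)))
                    (subst (k + m' + 2 ≤_) (sym (relabelB-> k r (≰⇒> v≰r)))
                      (+-monoˡ-≤ 2 (+-monoʳ-≤ k (W.≤prefixMax m' 1≤m' m'≤)))))
                  (m≤n⊔m (suc N) _)

  L≤maximum : L ≤ maximum τ
  L≤maximum with k ≤? 0 | r ≤? 0
  ... | no k≰0 | _ =
    subst (_≤ maximum τ) (trans (maximum-interval⁺ _ (≰⇒> k≰0)) (sym (arith k r))) maximum-back≤maximum
    where
    arith : ∀ k r → suc k + ((r + r) + suc k) ≡ suc (suc k + (r + r)) + k
    arith = solve-∀
  ... | yes k≤0 | yes r≤0 = subst (_≤ maximum τ) (arith (n≤0⇒n≡0 k≤0) (n≤0⇒n≡0 r≤0)) h≤maximum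
    where
    arith : ∀ {k r} → k ≡ 0 → r ≡ 0 → suc (suc (k + r)) ≡ suc k + ((r + r) + suc k)
    arith refl refl = refl
  ... | yes k≤0 | no r≰0 = subst (_≤ maximum τ) maxMap maximum-map≤maximum
    where
    1≤r+r : 1 ≤ r + r
    1≤r+r = ≤-trans (≰⇒> r≰0) (m≤m+n r r)
    r<r+r : r < r + r
    r<r+r = subst (_< r + r) (+-identityʳ r) (+-monoʳ-< r (≰⇒> r≰0))
    arith : ∀ {k} r → k ≡ 0 → k + (r + r) + 2 ≡ suc k + ((r + r) + suc k)
    arith r refl = trans (+-comm (r + r) 2) (cong suc (+-comm 1 (r + r)))
    maxMap : maximum (map (relabelB k r) w) ≡ L
    maxMap = begin
      maximum (map (relabelB k r) w) ≡⟨ maximum-map⁺ (relabelB-mono k r) w (subst (1 ≤_) (sym W.length≡) 1≤r+r) ⟩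
      relabelB k r (maximum w)      ≡⟨ cong (relabelB k r) (W.maximum≡L 1≤r+r) ⟩
      relabelB k r (r + r)          ≡⟨ relabelB-> k r r<r+r ⟩
      k + (r + r) + 2               ≡⟨ arith r (n≤0⇒n≡0 k≤0) ⟩
      L                             ∎
      where open ≡-Reasoning

  private
    suc-N≤L : suc N ≤ L
    suc-N≤L = m+d≡n⇒m≤n (k + r) (arith k r)
      where
      arith : ∀ k r → suc (suc (k + r)) + (k + r) ≡ suc k + ((r + r) + suc k)
      arith = solve-∀

    relabel-bounded : ∀ v → 1 ≤ v → v ≤ r + r → 1 ≤ relabelB k r v × relabelB k r v ≤ L
    relabel-bounded v 1≤v v≤ =
      ≤-trans 1≤v (≤-trans (m≤n+m v k) (m≤m+n (k + v) _)) ,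
      ≤-trans (relabelB≤ k r v) (≤-trans (+-monoˡ-≤ 2 (+-monoʳ-≤ k v≤)) (m+d≡n⇒m≤n k (arith k r)))
      where
      arith : ∀ k r → k + (r + r) + 2 + k ≡ suc k + ((r + r) + suc k)
      arith = solve-∀

    invariant-L : CutInvariant L τ
    invariant-L = record
      { length≡    = length-τ
      ; bounded    = bounded-frame (s≤s z≤n) suc-N≤L (s≤s z≤n) (≤-trans (n≤1+n N) suc-N≤L)
                                   relabel-bounded W.bounded
      ; ≤prefixMax = ≤prefixMax-frame (λ m' 1≤m' m'≤ → <⇒≤ (middle< m' 1≤m' m'≤)) L≤maximum
      ; cut+head≤  = cut+head-frame
          (λ m _ m≤ N<m → ⊥-elim (<⇒≱ (s≤s (≤-trans m≤ (s≤s (m≤m+n k r)))) N<m))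
          (λ m' 1≤m' m'≤ cut → ⊥-elim (<⇒≱ (middle< m' 1≤m' m'≤) cut))
      }

  invariant : CutInvariant (N + N) τ
  invariant = subst (λ L → CutInvariant L τ) L≡N+N invariant-L

  count-cuts : count (isCut τ) 0 (N + N) ≡ 1
  count-cuts = begin
    count (isCut τ) 0 (N + N) ≡⟨ cong (count (isCut τ) 0) (sym L≡N+N) ⟩
    count (isCut τ) 0 L       ≡⟨ count-isCut (CutInvariant.maximum≤ invariant-L) ⟩
    count (suc N ≤ᵇ_) 0 (suc k) + count middleCut 0 (r + r) + 1
      ≡⟨ cong₂ (λ x y → x + y + 1) noFrontCut noMiddleCut ⟩
    1 ∎
    where
    open ≡-Reasoning
    noFrontCut : count (suc N ≤ᵇ_) 0 (suc k) ≡ 0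
    noFrontCut = count-none _ 0 (suc k) (λ m _ m≤ t → <⇒≱ (s≤s (≤-trans m≤ (s≤s (m≤m+n k r)))) (≤ᵇ⇒≤ _ _ t))
    noMiddleCut : count middleCut 0 (r + r) ≡ 0
    noMiddleCut = count-none _ 0 (r + r) (λ m' 1≤m' m'≤ t → <⇒≱ (middle< m' 1≤m' m'≤) (≤ᵇ⇒≤ _ _ t))

-- Counting cuts in case (a)

-- The increasing enumeration of (k0, k0+d] ∪ (k0+d+1, k0+d+1+2q] ∪ (k0+d+2+2q, k0+2d+2+2q],
-- the values that case (a) leaves for the recursive image.
relabelA : ℕ → ℕ → ℕ → ℕ → ℕ
relabelA k0 d q v = k0 + v + jump d v + jump (d + (q + q)) v

relabelA-mono : ∀ k0 d q → relabelA k0 d q Preserves _≤_ ⟶ _≤_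
relabelA-mono k0 d q v≤v' =
  +-mono-≤ (+-mono-≤ (+-monoʳ-≤ k0 v≤v') (jump-mono d v≤v')) (jump-mono (d + (q + q)) v≤v')

relabelA≥ : ∀ k0 d q v → k0 + v + jump d v ≤ relabelA k0 d q v
relabelA≥ k0 d q v = m≤m+n _ _

relabelA≤ : ∀ k0 d q v → relabelA k0 d q v ≤ k0 + v + 2
relabelA≤ k0 d q v =
  subst (relabelA k0 d q v ≤_) (+-assoc (k0 + v) 1 1)
        (+-mono-≤ (+-monoʳ-≤ (k0 + v) (jump≤1 d v)) (jump≤1 (d + (q + q)) v))

relabelA-≤ : ∀ k0 d q {v} → v ≤ d + (q + q) → relabelA k0 d q v ≤ k0 + v + 1
relabelA-≤ k0 d q {v} v≤ rewrite jump-≤ {d + (q + q)} v≤ | +-identityʳ (k0 + v + jump d v) =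
  +-monoʳ-≤ (k0 + v) (jump≤1 d v)

relabelA-> : ∀ k0 d q {v} → d + (q + q) < v → relabelA k0 d q v ≡ k0 + v + 2
relabelA-> k0 d q {v} d+2q<v =
  trans (cong₂ (λ x y → k0 + v + x + y) (jump-> (≤-<-trans (m≤m+n d (q + q)) d+2q<v)) (jump-> d+2q<v))
        (+-assoc (k0 + v) 1 1)

module CaseA (k0 d q : ℕ) (w : List ℕ) (inv-w : CutInvariant ((d + q) + (d + q)) w)
             (d≤head : d ≤ prefixMax w 1) where

  private
    module W = CutInvariant inv-w

  N l : ℕ
  N = suc k0 + d + q
  l = (d + q) + (d + q)

  open Frame (suc (k0 + d)) k0 (relabelA k0 d q) w l (suc (suc (k0 + d + (q + q)))) W.length≡
                   (relabelA-mono k0 d q) (s≤s (m≤m+n k0 d)) public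

  private
    g : ℕ → ℕ
    g = relabelA k0 d q

    d+2q<l : 1 ≤ d → d + (q + q) < l
    d+2q<l 1≤d = m+d≡n⇒m≤n (d ∸ 1) (arith d q (sym (m+[n∸m]≡n 1≤d)))
      where
      arith : ∀ d q {d'} → d ≡ 1 + d' → suc (d + (q + q)) + d' ≡ (d + q) + (d + q)
      arith _ q {d'} refl = solve-∀-at d' q
        where
        solve-∀-at : ∀ d' q → suc (suc d' + (q + q)) + d' ≡ (suc d' + q) + (suc d' + q)
        solve-∀-at = solve-∀

    1≤l : 1 ≤ d → 1 ≤ l
    1≤l 1≤d = ≤-trans (s≤s z≤n) (d+2q<l 1≤d)

    g-l : 1 ≤ d → g l ≡ k0 + l + 2
    g-l 1≤d = relabelA-> k0 d q (d+2q<l 1≤d)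

  middle≤ : ∀ m' → 1 ≤ m' → m' ≤ l → suc k0 + m' ≤ suc (k0 + d) ⊔ g (prefixMax w m')
  middle≤ m' 1≤m' m'≤l with prefixMax w m' ≤? d
  ... | yes v≤d = ≤-trans (s≤s (+-monoʳ-≤ k0 (≤-trans (W.≤prefixMax m' 1≤m' m'≤l) v≤d)))
                          (m≤m⊔n (suc (k0 + d)) (g (prefixMax w m')))
  ... | no  v≰d = ≤-trans (≤-trans (≤-reflexive (+-comm 1 (k0 + m')))
                    (subst (λ x → k0 + m' + 1 ≤ k0 + prefixMax w m' + x) (sym (jump-> (≰⇒> v≰d)))
                      (+-monoˡ-≤ 1 (+-monoʳ-≤ k0 (W.≤prefixMax m' 1≤m' m'≤l)))))
                  (≤-trans (relabelA≥ k0 d q _) (m≤n⊔m (suc (k0 + d)) (g (prefixMax w m'))))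

  middleCut⇒isCut : ∀ m' → suc (k0 + d) ⊔ g (prefixMax w m') ≤ suc k0 + m' → prefixMax w m' ≤ m'
  middleCut⇒isCut m' cut with prefixMax w m' ≤? d
  ... | yes v≤d = ≤-trans v≤d (+-cancelˡ-≤ (suc k0) d m' (m⊔n≤o⇒m≤o (suc (k0 + d)) (g (prefixMax w m')) cut))
  ... | no  v≰d = +-cancelˡ-≤ (suc k0) _ _ (subst (_≤ suc k0 + m') shape
                    (≤-trans (relabelA≥ k0 d q _) (m⊔n≤o⇒n≤o (suc (k0 + d)) (g (prefixMax w m')) cut)))
    where
    shape : k0 + prefixMax w m' + jump d (prefixMax w m') ≡ suc k0 + prefixMax w m'
    shape = trans (cong (k0 + prefixMax w m' +_) (jump-> (≰⇒> v≰d))) (+-comm (k0 + prefixMax w m') 1)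

  isCut⇒middleCut : ∀ m' → d ≤ m' → prefixMax w m' ≤ m' → prefixMax w m' ≤ d + (q + q) →
                    suc (k0 + d) ⊔ g (prefixMax w m') ≤ suc k0 + m'
  isCut⇒middleCut m' d≤m' v≤m' v≤ =
    ⊔-lub (s≤s (+-monoʳ-≤ k0 d≤m'))
          (≤-trans (relabelA-≤ k0 d q v≤)
                   (subst (k0 + prefixMax w m' + 1 ≤_) (+-comm (k0 + m') 1) (+-monoˡ-≤ 1 (+-monoʳ-≤ k0 v≤m'))))

  no-middleCut-at-l : 1 ≤ d → suc k0 + l < suc (k0 + d) ⊔ g (prefixMax w l)
  no-middleCut-at-l 1≤d =
    ≤-trans (≤-reflexive (sym (trans (cong g (W.prefixMax-L (1≤l 1≤d))) (trans (g-l 1≤d) (+-comm (k0 + l) 2)))))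
            (m≤n⊔m (suc (k0 + d)) (g (prefixMax w l)))

  room : ∀ m' → 1 ≤ m' → m' ≤ l → prefixMax w m' ≤ m' → m' < l ⊎ d ≡ 0 → m' + d ≤ l
  room m' 1≤m' _ cut (inj₁ m'<l) = ≤-trans (+-monoʳ-≤ m' d≤head) (W.cut+head≤ m' 1≤m' m'<l cut)
  room m' _ m'≤l _ (inj₂ refl) = subst (_≤ l) (sym (+-identityʳ m')) m'≤l

  L≡N+N : L ≡ N + N
  L≡N+N = arith k0 d q
    where
    arith : ∀ k0 d q → suc k0 + (((d + q) + (d + q)) + suc k0) ≡ (suc k0 + d + q) + (suc k0 + d + q)
    arith = solve-∀

  L≤maximum : L ≤ maximum τ
  L≤maximum with k0 ≤? 0 | d ≤? 0
  ... | no k0≰0 | _ =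
    subst (_≤ maximum τ) (trans (maximum-interval⁺ _ (≰⇒> k0≰0)) (sym (arith k0 l))) maximum-back≤maximum
    where
    arith : ∀ k0 l → suc k0 + (l + suc k0) ≡ suc (suc k0 + l) + k0
    arith = solve-∀
  ... | yes k0≤0 | yes d≤0 = subst (_≤ maximum τ) (arith (n≤0⇒n≡0 k0≤0) (n≤0⇒n≡0 d≤0)) z≤maximum
    where
    arith : ∀ {k0 d} → k0 ≡ 0 → d ≡ 0 → suc (suc (k0 + d + (q + q))) ≡ suc k0 + (((d + q) + (d + q)) + suc k0)
    arith refl refl = cong suc (+-comm 1 (q + q))
  ... | yes k0≤0 | no d≰0 = subst (_≤ maximum τ) maxMap maximum-map≤maximum
    where
    arith : ∀ {k0} → k0 ≡ 0 → k0 + l + 2 ≡ suc k0 + (l + suc k0)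
    arith refl = trans (+-comm l 2) (cong suc (+-comm 1 l))
    maxMap : maximum (map g w) ≡ L
    maxMap = begin
      maximum (map g w) ≡⟨ maximum-map⁺ (relabelA-mono k0 d q) w
                             (subst (1 ≤_) (sym W.length≡) (1≤l (≰⇒> d≰0))) ⟩
      g (maximum w)     ≡⟨ cong g (W.maximum≡L (1≤l (≰⇒> d≰0))) ⟩
      g l               ≡⟨ g-l (≰⇒> d≰0) ⟩
      k0 + l + 2        ≡⟨ arith (n≤0⇒n≡0 k0≤0) ⟩
      L                 ∎
      where open ≡-Reasoning

  private
    h≤L : suc (k0 + d) ≤ L
    h≤L = m+d≡n⇒m≤n (suc k0 + d + (q + q)) (arith k0 d q)
      where
      arith : ∀ k0 d q → suc (k0 + d) + (suc k0 + d + (q + q)) ≡ suc k0 + (((d + q) + (d + q)) + suc k0)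
      arith = solve-∀

    z≤L : suc (suc (k0 + d + (q + q))) ≤ L
    z≤L = m+d≡n⇒m≤n (k0 + d) (arith k0 d q)
      where
      arith : ∀ k0 d q → suc (suc (k0 + d + (q + q))) + (k0 + d) ≡ suc k0 + (((d + q) + (d + q)) + suc k0)
      arith = solve-∀

    relabel-bounded : ∀ v → 1 ≤ v → v ≤ l → 1 ≤ g v × g v ≤ L
    relabel-bounded v 1≤v v≤l =
      ≤-trans 1≤v (≤-trans (m≤n+m v k0) (≤-trans (m≤m+n (k0 + v) _) (relabelA≥ k0 d q v))) ,
      ≤-trans (relabelA≤ k0 d q v) (≤-trans (+-monoˡ-≤ 2 (+-monoʳ-≤ k0 v≤l)) (m+d≡n⇒m≤n k0 (arith k0 l)))
      where
      arith : ∀ k0 l → k0 + l + 2 + k0 ≡ suc k0 + (l + suc k0)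
      arith = solve-∀

    front-cut : ∀ m → 1 ≤ m → m ≤ suc k0 → suc (k0 + d) ≤ m → m + suc (k0 + d) ≤ L
    front-cut m _ m≤ _ = ≤-trans (+-monoˡ-≤ (suc (k0 + d)) m≤) (m+d≡n⇒m≤n (d + (q + q)) (arith k0 d q))
      where
      arith : ∀ k0 d q → suc k0 + suc (k0 + d) + (d + (q + q)) ≡ suc k0 + (((d + q) + (d + q)) + suc k0)
      arith = solve-∀

    middle-cut : ∀ m' → 1 ≤ m' → m' ≤ l → suc (k0 + d) ⊔ g (prefixMax w m') ≤ suc k0 + m' →
                 suc k0 + m' + suc (k0 + d) ≤ L
    middle-cut m' 1≤m' m'≤l cut =
      ≤-trans (≤-reflexive (arith k0 m' d))
              (+-monoʳ-≤ (suc k0) (+-monoˡ-≤ (suc k0) (room m' 1≤m' m'≤l (middleCut⇒isCut m' cut) proper)))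
      where
      arith : ∀ k0 m' d → suc k0 + m' + suc (k0 + d) ≡ suc k0 + ((m' + d) + suc k0)
      arith = solve-∀
      proper : m' < l ⊎ d ≡ 0
      proper with m' <? l | d ≤? 0
      ... | yes m'<l | _       = inj₁ m'<l
      ... | no  _    | yes d≤0 = inj₂ (n≤0⇒n≡0 d≤0)
      ... | no  m'≮l | no d≰0  rewrite ≤-antisym m'≤l (≮⇒≥ m'≮l) =
        ⊥-elim (<⇒≱ (no-middleCut-at-l (≰⇒> d≰0)) cut)

    invariant-L : CutInvariant L τ
    invariant-L = record
      { length≡    = length-τ
      ; bounded    = bounded-frame (s≤s z≤n) h≤L (s≤s z≤n) z≤L relabel-bounded W.bounded
      ; ≤prefixMax = ≤prefixMax-frame middle≤ L≤maximum
      ; cut+head≤  = cut+head-frame front-cut middle-cut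
      }

  invariant : CutInvariant (N + N) τ
  invariant = subst (λ L → CutInvariant L τ) L≡N+N invariant-L

  middleCut≡isCut : ∀ m' → 1 ≤ m' → m' ≤ l → m' < l ⊎ d ≡ 0 → middleCut m' ≡ isCut w m'
  middleCut≡isCut m' 1≤m' m'≤l proper = T-injective
    (λ t → ≤⇒≤ᵇ (middleCut⇒isCut m' (≤ᵇ⇒≤ _ _ t)))
    (λ t → ≤⇒≤ᵇ (isCut⇒middleCut m' (d≤m' (≤ᵇ⇒≤ _ _ t)) (≤ᵇ⇒≤ _ _ t) (v≤ (≤ᵇ⇒≤ _ _ t))))
    where
    d≤m' : prefixMax w m' ≤ m' → d ≤ m'
    d≤m' cut = ≤-trans d≤head (≤-trans (prefixMax-mono w 1≤m') cut)
    v≤ : prefixMax w m' ≤ m' → prefixMax w m' ≤ d + (q + q)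
    v≤ cut = +-cancelʳ-≤ d _ _
      (≤-trans (+-monoˡ-≤ d cut) (≤-trans (room m' 1≤m' m'≤l cut proper) (≤-reflexive (arith d q))))
      where
      arith : ∀ d q → (d + q) + (d + q) ≡ d + (q + q) + d
      arith = solve-∀

  count-cuts-flat : d ≡ 0 → count (isCut τ) 0 (N + N) ≡ 2 + count (isCut w) 0 l
  count-cuts-flat d≡0 = begin
    count (isCut τ) 0 (N + N)   ≡⟨ cong (count (isCut τ) 0) (sym L≡N+N) ⟩
    count (isCut τ) 0 L         ≡⟨ count-isCut (CutInvariant.maximum≤ invariant-L) ⟩
    count (suc (k0 + d) ≤ᵇ_) 0 (suc k0) + count middleCut 0 l + 1
      ≡⟨ cong₂ (λ x y → x + y + 1) frontCut middleCuts ⟩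
    1 + count (isCut w) 0 l + 1 ≡⟨ +-comm (1 + count (isCut w) 0 l) 1 ⟩
    2 + count (isCut w) 0 l     ∎
    where
    open ≡-Reasoning
    frontCut : count (suc (k0 + d) ≤ᵇ_) 0 (suc k0) ≡ 1
    frontCut = begin
      count (suc (k0 + d) ≤ᵇ_) 0 (suc k0)                                  ≡⟨ count-snoc _ k0 ⟩
      count (suc (k0 + d) ≤ᵇ_) 0 k0 + count (suc (k0 + d) ≤ᵇ_) k0 1
        ≡⟨ cong₂ _+_ (count-none _ 0 k0 (λ m _ m≤k0 t → <⇒≱ (s≤s (≤-trans m≤k0 (m≤m+n k0 d))) (≤ᵇ⇒≤ _ _ t)))
                     (count-single (suc (k0 + d) ≤ᵇ_) k0
                                   (≤⇒≤ᵇ (s≤s (≤-reflexive (trans (cong (k0 +_) d≡0) (+-identityʳ k0)))))) ⟩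
      1 ∎
    middleCuts : count middleCut 0 l ≡ count (isCut w) 0 l
    middleCuts = count-cong 0 l (λ m' 1≤m' m'≤l → middleCut≡isCut m' 1≤m' m'≤l (inj₂ d≡0))

  count-cuts-raised : 1 ≤ d → count (isCut τ) 0 (N + N) ≡ count (isCut w) 0 l
  count-cuts-raised 1≤d = begin
    count (isCut τ) 0 (N + N)      ≡⟨ cong (count (isCut τ) 0) (sym L≡N+N) ⟩
    count (isCut τ) 0 L            ≡⟨ count-isCut (CutInvariant.maximum≤ invariant-L) ⟩
    count (suc (k0 + d) ≤ᵇ_) 0 (suc k0) + count middleCut 0 l + 1
      ≡⟨ cong₂ (λ x y → x + y + 1) noFrontCut middleCuts ⟩
    count (isCut w) 0 l' + 1       ≡⟨ sym wCuts ⟩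
    count (isCut w) 0 l            ∎
    where
    open ≡-Reasoning
    l' : ℕ
    l' = pred l
    l≡ : l ≡ suc l'
    l≡ = sym (suc-pred l ⦃ >-nonZero (1≤l 1≤d) ⦄)
    noFrontCut : count (suc (k0 + d) ≤ᵇ_) 0 (suc k0) ≡ 0
    noFrontCut = count-none _ 0 (suc k0) (λ m _ m≤ t →
      <⇒≱ (≤-trans (s≤s m≤) (s≤s (subst (_≤ k0 + d) (+-comm k0 1) (+-monoʳ-≤ k0 1≤d)))) (≤ᵇ⇒≤ _ _ t))
    middleCuts : count middleCut 0 l ≡ count (isCut w) 0 l'
    middleCuts = begin
      count middleCut 0 l                                ≡⟨ cong (count middleCut 0) l≡ ⟩
      count middleCut 0 (suc l')                         ≡⟨ count-snoc middleCut l' ⟩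
      count middleCut 0 l' + count middleCut l' 1
        ≡⟨ cong₂ _+_ (count-cong 0 l' (λ m' 1≤m' m'≤ →
                       middleCut≡isCut m' 1≤m' (<⇒≤ (m'<l m'≤)) (inj₁ (m'<l m'≤))))
                     (count-none middleCut l' 1 (λ v l'<v v≤ t → <⇒≱ (no-middleCut-at-l 1≤d)
                        (subst (λ x → suc (k0 + d) ⊔ g (prefixMax w x) ≤ suc k0 + x) (v≡l l'<v v≤) (≤ᵇ⇒≤ _ _ t)))) ⟩
      count (isCut w) 0 l' + 0                           ≡⟨ +-identityʳ _ ⟩
      count (isCut w) 0 l'                               ∎
      where
      m'<l : ∀ {m'} → m' ≤ l' → m' < l
      m'<l {m'} m'≤ = subst (m' <_) (sym l≡) (s≤s m'≤)
      v≡l : ∀ {v} → l' < v → v ≤ l' + 1 → v ≡ l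
      v≡l {v} l'<v v≤ = trans (≤-antisym (subst (v ≤_) (+-comm l' 1) v≤) l'<v) (sym l≡)
    wCuts : count (isCut w) 0 l ≡ count (isCut w) 0 l' + 1
    wCuts = begin
      count (isCut w) 0 l                                ≡⟨ cong (count (isCut w) 0) l≡ ⟩
      count (isCut w) 0 (suc l')                         ≡⟨ count-snoc (isCut w) l' ⟩
      count (isCut w) 0 l' + count (isCut w) l' 1
        ≡⟨ cong (count (isCut w) 0 l' +_) (count-single (isCut w) l' (subst (T ∘ isCut w) l≡ W.isCut-L)) ⟩
      count (isCut w) 0 l' + 1                           ∎

-- The three where-clauses of psi, restated so that psi-unfold can expose them.
module PsiCases (j k n : ℕ) where

  m : ℕ
  m = 2 * n

  caseA : List ℕ → List ℕ
  caseA ψ =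
    (suc m ∸ j)
    ∷ map (λ i → (m + 2) ∸ i) (map (2 +_) (upTo (k ∸ 1)))
    ++ embed (complementIn m (λ v → (v ≤ᵇ (k ∸ 1)) ∨ (v ≡ᵇ j) ∨ (v ≡ᵇ (suc m ∸ j))
                                      ∨ (((m + 2) ∸ k) ≤ᵇ v)))
             ψ
    ++ reverse (range1 (k ∸ 1))
    ++ j ∷ []

  caseB : List ℕ → List ℕ
  caseB ψ =
    n
    ∷ map (λ i → (m + 2) ∸ i) (map (2 +_) (upTo k))
    ++ embed (complementIn m (λ v → (v ≤ᵇ k) ∨ (v ≡ᵇ n) ∨ (v ≡ᵇ suc n)
                                      ∨ ((suc m ∸ k) ≤ᵇ v)))
             ψ
    ++ reverse (range1 k)
    ++ suc n ∷ []

  caseC : List ℕ → List ℕ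
  caseC ψ =
    n
    ∷ embed (complementIn m (λ v → (v ≡ᵇ n) ∨ (v ≡ᵇ suc n)))
            ψ
    ++ suc n ∷ []

  step : ℕ → List Step → List ℕ
  step f π' =
    if j ≤ᵇ n then caseA (psi f (replicate (j ∸ k) U ++ π'))
    else if j ≡ᵇ suc n then caseB (psi f (replicate (n ∸ k ∸ 1) U ++ π'))
    else caseC (psi f (replicate (j ∸ 2) U ++ replicate k D ++ π'))

  step-caseA : ∀ {f π'} → j ≤ n → step f π' ≡ caseA (psi f (replicate (j ∸ k) U ++ π'))
  step-caseA j≤n with j ≤ᵇ n | ≤⇒≤ᵇ j≤n
  ... | true | _ = refl

  step-caseB : ∀ {f π'} → j ≡ suc n → step f π' ≡ caseB (psi f (replicate (n ∸ k ∸ 1) U ++ π'))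
  step-caseB j≡ with j ≤ᵇ n | ¬T-≤ᵇ (≤-reflexive (sym j≡)) | j ≡ᵇ suc n | ≡⇒≡ᵇ j (suc n) j≡
  ... | false | _ | true | _ = refl
  ... | true  | ¬t | _   | _ = ⊥-elim (¬t _)

  step-caseC : ∀ {f π'} → suc n < j → step f π' ≡ caseC (psi f (replicate (j ∸ 2) U ++ replicate k D ++ π'))
  step-caseC sn<j with j ≤ᵇ n | ¬T-≤ᵇ (<-trans (n<1+n n) sn<j) | j ≡ᵇ suc n | ¬T-≡ᵇ (>⇒≢ sn<j)
  ... | false | _  | false | _   = refl
  ... | true  | ¬t | _     | _   = ⊥-elim (¬t _)
  ... | false | _  | true  | ¬t′ = ⊥-elim (¬t′ _)

psi-unfold : ∀ f s ss {j r k π'} → leadU (s ∷ ss) ≡ (j , r) → leadD r ≡ (k , π') →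
             psi (suc f) (s ∷ ss) ≡ PsiCases.step j k ⌊ length (s ∷ ss) /2⌋ f π'
psi-unfold f s ss eqU eqD rewrite eqU | eqD = refl

reverse-shape : ∀ (x : ℕ) X E R y →
  reverse (x ∷ X ++ E ++ R ++ y ∷ []) ≡ y ∷ reverse R ++ reverse E ++ reverse X ++ x ∷ []
reverse-shape x X E R y = begin
  reverse (x ∷ X ++ E ++ R ++ y ∷ [])
    ≡⟨ unfold-reverse x (X ++ E ++ R ++ y ∷ []) ⟩
  reverse (X ++ E ++ R ++ y ∷ []) ++ x ∷ []
    ≡⟨ cong (_++ x ∷ []) (reverse-++ X (E ++ R ++ y ∷ [])) ⟩
  (reverse (E ++ R ++ y ∷ []) ++ reverse X) ++ x ∷ []
    ≡⟨ cong (λ t → (t ++ reverse X) ++ x ∷ []) (reverse-++ E (R ++ y ∷ [])) ⟩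
  ((reverse (R ++ y ∷ []) ++ reverse E) ++ reverse X) ++ x ∷ []
    ≡⟨ cong (λ t → ((t ++ reverse E) ++ reverse X) ++ x ∷ []) (reverse-++ R (y ∷ [])) ⟩
  (((y ∷ reverse R) ++ reverse E) ++ reverse X) ++ x ∷ []
    ≡⟨ ++-assoc ((y ∷ reverse R) ++ reverse E) (reverse X) (x ∷ []) ⟩
  ((y ∷ reverse R) ++ reverse E) ++ reverse X ++ x ∷ []
    ≡⟨ ++-assoc (y ∷ reverse R) (reverse E) (reverse X ++ x ∷ []) ⟩
  y ∷ reverse R ++ reverse E ++ reverse X ++ x ∷ [] ∎
  where open ≡-Reasoning

reverse-applyUpTo : ∀ b c (f : ℕ → ℕ) → (∀ i → i < c → f i ≡ b + c ∸ i) →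
                    reverse (applyUpTo f c) ≡ interval b c
reverse-applyUpTo b zero    f _      = refl
reverse-applyUpTo b (suc c) f f≡ = begin
  reverse (f 0 ∷ applyUpTo (f ∘ suc) c)
    ≡⟨ unfold-reverse (f 0) (applyUpTo (f ∘ suc) c) ⟩
  reverse (applyUpTo (f ∘ suc) c) ++ f 0 ∷ []
    ≡⟨ cong₂ (λ xs x → xs ++ x ∷ [])
             (reverse-applyUpTo b c (f ∘ suc) (λ i i<c →
               trans (f≡ (suc i) (s≤s i<c)) (cong (_∸ suc i) (+-suc b c))))
             (f≡ 0 (s≤s z≤n)) ⟩
  interval b c ++ b + suc c ∷ []
    ≡⟨ cong (λ x → interval b c ++ x ∷ []) (+-suc b c) ⟩
  interval b c ++ interval (b + c) 1
    ≡⟨ sym (interval-++ b c 1) ⟩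
  interval b (c + 1)
    ≡⟨ cong (interval b) (+-comm c 1) ⟩
  interval b (suc c) ∎
  where open ≡-Reasoning

reverse-descending : ∀ M b c → M ≡ b + c →
                     reverse (map (λ i → (M + 2) ∸ i) (map (2 +_) (upTo c))) ≡ interval b c
reverse-descending M b c M≡ = begin
  reverse (map (λ i → (M + 2) ∸ i) (map (2 +_) (upTo c)))
    ≡⟨ cong reverse (cong (map (λ i → (M + 2) ∸ i)) (map-applyUpTo (λ i → i) (2 +_) c)) ⟩
  reverse (map (λ i → (M + 2) ∸ i) (applyUpTo (2 +_) c))
    ≡⟨ cong reverse (map-applyUpTo (2 +_) (λ i → (M + 2) ∸ i) c) ⟩
  reverse (applyUpTo (λ i → (M + 2) ∸ (2 + i)) c)
    ≡⟨ reverse-applyUpTo b c _ (λ i _ → trans (cong (_∸ (2 + i)) (+-comm M 2)) (cong (_∸ i) M≡)) ⟩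
  interval b c ∎
  where open ≡-Reasoning

reverse-reverse-range1 : ∀ c → reverse (reverse (range1 c)) ≡ interval 0 c
reverse-reverse-range1 c = trans (reverse-involutive (range1 c)) (range1≡interval c)

reverse-embed : ∀ S ψ (g : ℕ → ℕ) L → All (λ v → 1 ≤ v × v ≤ L) (reverse ψ) →
                (∀ v → 1 ≤ v → v ≤ L → nth S (v ∸ 1) ≡ g v) → reverse (embed S ψ) ≡ map g (reverse ψ)
reverse-embed S ψ g L bounded nth≡ = trans (sym (reverse-map (λ v → nth S (v ∸ 1)) ψ)) (map-cong bounded)
  where
  map-cong : ∀ {xs} → All (λ v → 1 ≤ v × v ≤ L) xs → map (λ v → nth S (v ∸ 1)) xs ≡ map g xs
  map-cong []                  = refl
  map-cong ((1≤v , v≤L) ∷ bs) = cong₂ _∷_ (nth≡ _ 1≤v v≤L) (map-cong bs)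

nth-++ˡ : ∀ X Y {i} → i < length X → nth (X ++ Y) i ≡ nth X i
nth-++ˡ (x ∷ X) Y {zero}  _         = refl
nth-++ˡ (x ∷ X) Y {suc i} (s≤s i<) = nth-++ˡ X Y i<

nth-++ʳ : ∀ X Y i → nth (X ++ Y) (length X + i) ≡ nth Y i
nth-++ʳ []      Y i = refl
nth-++ʳ (x ∷ X) Y i = nth-++ʳ X Y i

module Complement (removed : ℕ → Bool) where

  kept : ℕ → ℕ → List ℕ
  kept a b = filterᵇ (not ∘ removed) (interval a b)

  private
    T-not : ∀ {x} → ¬ T x → T (not x)
    T-not {false} _  = _
    T-not {true}  ¬t = ¬t _

    ¬T-not : ∀ {x} → T x → ¬ T (not x)
    ¬T-not {true} _ ()

    kept-++ : ∀ a b c → kept a (b + c) ≡ kept a b ++ kept (a + b) c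
    kept-++ a b c = trans (cong (filterᵇ (not ∘ removed)) (interval-++ a b c))
                          (filter-++ (T? ∘ not ∘ removed) (interval a b) (interval (a + b) c))

  kept-none : ∀ a b → (∀ v → a < v → v ≤ a + b → T (removed v)) → kept a b ≡ []
  kept-none a b rem =
    filter-none (T? ∘ not ∘ removed) (All.map (λ (lo , hi) → ¬T-not (rem _ lo hi)) (All-interval a b))

  kept-all : ∀ a b → (∀ v → a < v → v ≤ a + b → ¬ T (removed v)) → kept a b ≡ interval a b
  kept-all a b ret = filter-all (T? ∘ not ∘ removed) (All.map (λ (lo , hi) → T-not (ret _ lo hi)) (All-interval a b))

  kept-drop : ∀ a b c → (∀ v → a < v → v ≤ a + b → T (removed v)) → kept a (b + c) ≡ kept (a + b) c
  kept-drop a b c rem = trans (kept-++ a b c) (cong (_++ kept (a + b) c) (kept-none a b rem))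

  kept-keep : ∀ a b c → (∀ v → a < v → v ≤ a + b → ¬ T (removed v)) →
              kept a (b + c) ≡ interval a b ++ kept (a + b) c
  kept-keep a b c ret = trans (kept-++ a b c) (cong (_++ kept (a + b) c) (kept-all a b ret))

  kept-drop-one : ∀ a c → T (removed (suc a)) → kept a (suc c) ≡ kept (suc a) c
  kept-drop-one a c t with removed (suc a)
  ... | true = refl

module ComplementB (k r : ℕ) where

  N : ℕ
  N = suc (k + r)

  removed : ℕ → Bool
  removed v = (v ≤ᵇ k) ∨ (v ≡ᵇ N) ∨ (v ≡ᵇ suc N) ∨ ((suc (2 * N) ∸ k) ≤ᵇ v)

  open Complement removed

  private
    top≡ : suc (2 * N) ∸ k ≡ suc (suc N + r)
    top≡ = trans (cong (_∸ k) (arith k r)) (m+n∸m≡n k (suc (suc N + r)))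
      where
      arith : ∀ k r → suc (2 * suc (k + r)) ≡ k + suc (suc (suc (k + r)) + r)
      arith = solve-∀

    not-removed : ∀ {v} → k < v → v ≢ N → v ≢ suc N → v < suc (suc N + r) → ¬ T (removed v)
    not-removed {v} k<v v≢N v≢sN v<top =
      ¬T-∨ (¬T-≤ᵇ k<v) (¬T-∨ (¬T-≡ᵇ v≢N) (¬T-∨ (¬T-≡ᵇ v≢sN)
                                                (¬T-≤ᵇ (subst (v <_) (sym top≡) v<top))))

  complement : complementIn (2 * N) removed ≡ interval k r ++ interval (suc N) r
  complement = begin
    complementIn (2 * N) removed
      ≡⟨ cong (filterᵇ (not ∘ removed)) (range1≡interval (2 * N)) ⟩
    kept 0 (2 * N)
      ≡⟨ cong (kept 0) (arith k r) ⟩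
    kept 0 (k + (r + suc (suc (r + k))))
      ≡⟨ kept-drop 0 k _ (λ v _ v≤k → T-∨ˡ _ (≤⇒≤ᵇ v≤k)) ⟩
    kept k (r + suc (suc (r + k)))
      ≡⟨ kept-keep k r _ (λ v k<v v≤ → not-removed k<v (<⇒≢ (s≤s v≤)) (<⇒≢ (m≤n⇒m≤1+n (s≤s v≤)))
                                          (≤-trans (s≤s v≤) (≤-trans (n≤1+n _) (≤-trans (n≤1+n _) (s≤s (m≤m+n (suc N) r)))))) ⟩
    interval k r ++ kept (k + r) (suc (suc (r + k)))
      ≡⟨ cong (interval k r ++_) (kept-drop-one (k + r) _ (T-∨ʳ (suc (k + r) ≤ᵇ k) (T-∨ˡ _ (≡⇒≡ᵇ N N refl)))) ⟩
    interval k r ++ kept N (suc (r + k))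
      ≡⟨ cong (interval k r ++_)
              (kept-drop-one N _ (T-∨ʳ (suc N ≤ᵇ k) (T-∨ʳ (suc N ≡ᵇ N) (T-∨ˡ _ (≡⇒≡ᵇ (suc N) (suc N) refl))))) ⟩
    interval k r ++ kept (suc N) (r + k)
      ≡⟨ cong (interval k r ++_) (kept-keep (suc N) r k (λ v sN<v v≤ →
           not-removed (<-trans (s≤s (m≤m+n k r)) (<-trans (n<1+n N) sN<v)) (>⇒≢ (<-trans (n<1+n N) sN<v))
                       (>⇒≢ sN<v) (s≤s v≤))) ⟩
    interval k r ++ interval (suc N) r ++ kept (suc N + r) k
      ≡⟨ cong (λ xs → interval k r ++ interval (suc N) r ++ xs)
              (kept-none (suc N + r) k (λ v top<v _ → T-∨ʳ (v ≤ᵇ k) (T-∨ʳ (v ≡ᵇ N) (T-∨ʳ (v ≡ᵇ suc N)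
                (≤⇒≤ᵇ (subst (_≤ v) (sym top≡) top<v)))))) ⟩
    interval k r ++ interval (suc N) r ++ []
      ≡⟨ cong (interval k r ++_) (++-identityʳ _) ⟩
    interval k r ++ interval (suc N) r ∎
    where
    open ≡-Reasoning
    arith : ∀ k r → 2 * suc (k + r) ≡ k + (r + suc (suc (r + k)))
    arith = solve-∀

module ComplementC (r : ℕ) where

  N : ℕ
  N = suc r

  removed : ℕ → Bool
  removed v = (v ≡ᵇ N) ∨ (v ≡ᵇ suc N)

  open Complement removed

  private
    not-removed : ∀ {v} → v ≢ N → v ≢ suc N → ¬ T (removed v)
    not-removed v≢N v≢sN = ¬T-∨ (¬T-≡ᵇ v≢N) (¬T-≡ᵇ v≢sN)

  complement : complementIn (2 * N) removed ≡ interval 0 r ++ interval (suc N) r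
  complement = begin
    complementIn (2 * N) removed
      ≡⟨ cong (filterᵇ (not ∘ removed)) (range1≡interval (2 * N)) ⟩
    kept 0 (2 * N)
      ≡⟨ cong (kept 0) (arith r) ⟩
    kept 0 (r + suc (suc r))
      ≡⟨ kept-keep 0 r _ (λ v _ v≤r → not-removed (<⇒≢ (s≤s v≤r)) (<⇒≢ (m≤n⇒m≤1+n (s≤s v≤r)))) ⟩
    interval 0 r ++ kept r (suc (suc r))
      ≡⟨ cong (interval 0 r ++_) (kept-drop-one r _ (T-∨ˡ _ (≡⇒≡ᵇ N N refl))) ⟩
    interval 0 r ++ kept N (suc r)
      ≡⟨ cong (interval 0 r ++_) (kept-drop-one N r (T-∨ʳ (suc N ≡ᵇ N) (≡⇒≡ᵇ (suc N) (suc N) refl))) ⟩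
    interval 0 r ++ kept (suc N) r
      ≡⟨ cong (interval 0 r ++_)
              (kept-all (suc N) r (λ v sN<v _ → not-removed (>⇒≢ (<-trans (n<1+n N) sN<v)) (>⇒≢ sN<v))) ⟩
    interval 0 r ++ interval (suc N) r ∎
    where
    open ≡-Reasoning
    arith : ∀ r → 2 * suc r ≡ r + suc (suc r)
    arith = solve-∀

nth-relabelB : ∀ k r v → 1 ≤ v → v ≤ r + r →
               nth (interval k r ++ interval (suc (suc (k + r))) r) (v ∸ 1) ≡ relabelB k r v
nth-relabelB k r (suc u) _ v≤ with <-or-offset u r
... | inj₁ u<r = begin
  nth (interval k r ++ _) u ≡⟨ nth-++ˡ (interval k r) _ (subst (u <_) (sym (length-interval k r)) u<r) ⟩
  nth (interval k r) u      ≡⟨ nth-interval k r u u<r ⟩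
  suc (k + u)               ≡⟨ sym (+-suc k u) ⟩
  k + suc u                 ≡⟨ sym (relabelB-≤ k r u<r) ⟩
  relabelB k r (suc u)      ∎
  where open ≡-Reasoning
... | inj₂ (u' , refl) = begin
  nth (interval k r ++ second) (r + u')
    ≡⟨ cong (λ x → nth (interval k r ++ second) (x + u')) (sym (length-interval k r)) ⟩
  nth (interval k r ++ second) (length (interval k r) + u')
    ≡⟨ nth-++ʳ (interval k r) second u' ⟩
  nth second u'
    ≡⟨ nth-interval _ r u' (+-cancelˡ-≤ r (suc u') r (subst (_≤ r + r) (sym (+-suc r u')) v≤)) ⟩
  suc (suc (suc (k + r)) + u')
    ≡⟨ arith k r u' ⟩
  k + suc (r + u') + 2
    ≡⟨ sym (relabelB-> k r (s≤s (m≤m+n r u'))) ⟩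
  relabelB k r (suc (r + u')) ∎
  where
  open ≡-Reasoning
  second : List ℕ
  second = interval (suc (suc (k + r))) r
  arith : ∀ k r u' → suc (suc (suc (k + r)) + u') ≡ k + suc (r + u') + 2
  arith = solve-∀

reverse-caseB : ∀ j k r ψ → All (λ v → 1 ≤ v × v ≤ r + r) (reverse ψ) →
  reverse (PsiCases.caseB j k (suc (k + r)) ψ)
    ≡ frame (suc (suc (k + r))) k (relabelB k r) (reverse ψ) (r + r) (suc (k + r))
reverse-caseB j k r ψ bounded =
  trans (reverse-shape (suc (k + r)) descending E (reverse (range1 k)) (suc (suc (k + r))))
        (cong (suc (suc (k + r)) ∷_) (cong₂ _++_ (reverse-reverse-range1 k)
          (cong₂ _++_ reverse-E (cong (_++ suc (k + r) ∷ []) reverse-descending′))))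
  where
  open PsiCases j k (suc (k + r))
  descending : List ℕ
  descending = map (λ i → (m + 2) ∸ i) (map (2 +_) (upTo k))
  E : List ℕ
  E = embed (complementIn m (ComplementB.removed k r)) ψ
  reverse-E : reverse E ≡ map (relabelB k r) (reverse ψ)
  reverse-E = reverse-embed (complementIn m (ComplementB.removed k r)) ψ (relabelB k r) (r + r) bounded (λ v 1≤v v≤ →
    trans (cong (λ S → nth S (v ∸ 1)) (ComplementB.complement k r)) (nth-relabelB k r v 1≤v v≤))
  reverse-descending′ : reverse descending ≡ interval (suc (suc k + (r + r))) k
  reverse-descending′ = reverse-descending m _ k (arith k r)
    where
    arith : ∀ k r → 2 * suc (k + r) ≡ suc (suc k + (r + r)) + k
    arith = solve-∀

reverse-caseC : ∀ j k r ψ → All (λ v → 1 ≤ v × v ≤ r + r) (reverse ψ) →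
  reverse (PsiCases.caseC j k (suc r) ψ) ≡ frame (suc (suc r)) 0 (relabelB 0 r) (reverse ψ) (r + r) (suc r)
reverse-caseC j k r ψ bounded =
  trans (reverse-shape (suc r) [] E [] (suc (suc r))) (cong (λ xs → suc (suc r) ∷ xs ++ suc r ∷ []) reverse-E)
  where
  open PsiCases j k (suc r)
  E : List ℕ
  E = embed (complementIn m (ComplementC.removed r)) ψ
  reverse-E : reverse E ≡ map (relabelB 0 r) (reverse ψ)
  reverse-E = reverse-embed (complementIn m (ComplementC.removed r)) ψ (relabelB 0 r) (r + r) bounded (λ v 1≤v v≤ →
    trans (cong (λ S → nth S (v ∸ 1)) (ComplementC.complement r)) (nth-relabelB 0 r v 1≤v v≤))

module ComplementA (k0 d q : ℕ) where

  N j T3 : ℕ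
  N  = suc k0 + d + q
  j  = suc k0 + d
  T3 = suc (j + (q + q))

  removed : ℕ → Bool
  removed v = (v ≤ᵇ (suc k0 ∸ 1)) ∨ (v ≡ᵇ j) ∨ (v ≡ᵇ (suc (2 * N) ∸ j)) ∨ (((2 * N + 2) ∸ suc k0) ≤ᵇ v)

  open Complement removed

  T3≡ : suc (2 * N) ∸ j ≡ T3
  T3≡ = trans (cong (_∸ j) (arith k0 d q)) (m+n∸m≡n j T3)
    where
    arith : ∀ k0 d q → suc (2 * (suc k0 + d + q)) ≡ suc k0 + d + suc (suc k0 + d + (q + q))
    arith = solve-∀

  private

    top≡ : (2 * N + 2) ∸ suc k0 ≡ suc (T3 + d)
    top≡ = trans (cong (_∸ suc k0) (arith k0 d q)) (m+n∸m≡n (suc k0) (suc (T3 + d)))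
      where
      arith : ∀ k0 d q → 2 * (suc k0 + d + q) + 2 ≡ suc k0 + suc (suc (suc k0 + d + (q + q)) + d)
      arith = solve-∀

    not-removed : ∀ {v} → k0 < v → v ≢ j → v ≢ T3 → v < suc (T3 + d) → ¬ T (removed v)
    not-removed {v} k0<v v≢j v≢T3 v<top =
      ¬T-∨ (¬T-≤ᵇ k0<v) (¬T-∨ (¬T-≡ᵇ v≢j) (¬T-∨ (¬T-≡ᵇ (subst (v ≢_) (sym T3≡) v≢T3))
                                               (¬T-≤ᵇ (subst (v <_) (sym top≡) v<top))))

    j<T3 : j < T3
    j<T3 = s≤s (m≤m+n j (q + q))

    T3<top : T3 < suc (T3 + d)
    T3<top = s≤s (m≤m+n T3 d)

  complement : complementIn (2 * N) removed ≡ interval k0 d ++ interval j (q + q) ++ interval T3 d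
  complement = begin
    complementIn (2 * N) removed
      ≡⟨ cong (filterᵇ (not ∘ removed)) (range1≡interval (2 * N)) ⟩
    kept 0 (2 * N)
      ≡⟨ cong (kept 0) (arith k0 d q) ⟩
    kept 0 (k0 + (d + suc ((q + q) + suc (d + k0))))
      ≡⟨ kept-drop 0 k0 _ (λ v _ v≤ → T-∨ˡ _ (≤⇒≤ᵇ v≤)) ⟩
    kept k0 (d + suc ((q + q) + suc (d + k0)))
      ≡⟨ kept-keep k0 d _ (λ v k0<v v≤ → let v<j = s≤s v≤ in
           not-removed k0<v (<⇒≢ v<j) (<⇒≢ (<-trans v<j j<T3)) (<-trans (<-trans v<j j<T3) T3<top)) ⟩
    interval k0 d ++ kept (k0 + d) (suc ((q + q) + suc (d + k0)))
      ≡⟨ cong (interval k0 d ++_) (kept-drop-one (k0 + d) _ (T-∨ʳ (j ≤ᵇ k0) (T-∨ˡ _ (≡⇒≡ᵇ j j refl)))) ⟩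
    interval k0 d ++ kept j ((q + q) + suc (d + k0))
      ≡⟨ cong (interval k0 d ++_) (kept-keep j (q + q) _ (λ v j<v v≤ → let v<T3 = s≤s v≤ in
           not-removed (≤-<-trans (m≤m+n k0 d) (<-trans (n<1+n _) j<v)) (>⇒≢ j<v) (<⇒≢ v<T3) (<-trans v<T3 T3<top))) ⟩
    interval k0 d ++ interval j (q + q) ++ kept (j + (q + q)) (suc (d + k0))
      ≡⟨ cong (λ xs → interval k0 d ++ interval j (q + q) ++ xs)
              (kept-drop-one (j + (q + q)) _ (T-∨ʳ (T3 ≤ᵇ k0) (T-∨ʳ (T3 ≡ᵇ j) (T-∨ˡ _ (≡⇒≡ᵇ T3 _ (sym T3≡)))))) ⟩
    interval k0 d ++ interval j (q + q) ++ kept T3 (d + k0)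
      ≡⟨ cong (λ xs → interval k0 d ++ interval j (q + q) ++ xs) (kept-keep T3 d k0 (λ v T3<v v≤ →
           not-removed (<-trans (≤-<-trans (m≤m+n k0 d) (<-trans (n<1+n _) j<T3)) T3<v) (>⇒≢ (<-trans j<T3 T3<v))
                       (>⇒≢ T3<v) (s≤s v≤))) ⟩
    interval k0 d ++ interval j (q + q) ++ interval T3 d ++ kept (T3 + d) k0
      ≡⟨ cong (λ xs → interval k0 d ++ interval j (q + q) ++ interval T3 d ++ xs)
              (kept-none (T3 + d) k0 (λ v top<v _ → T-∨ʳ (v ≤ᵇ k0) (T-∨ʳ (v ≡ᵇ j) (T-∨ʳ (v ≡ᵇ _)
                (≤⇒≤ᵇ (subst (_≤ v) (sym top≡) top<v)))))) ⟩
    interval k0 d ++ interval j (q + q) ++ interval T3 d ++ []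
      ≡⟨ cong (λ xs → interval k0 d ++ interval j (q + q) ++ xs) (++-identityʳ _) ⟩
    interval k0 d ++ interval j (q + q) ++ interval T3 d ∎
    where
    open ≡-Reasoning
    arith : ∀ k0 d q → 2 * (suc k0 + d + q) ≡ k0 + (d + suc ((q + q) + suc (d + k0)))
    arith = solve-∀

nth-relabelA : ∀ k0 d q v → 1 ≤ v → v ≤ (d + q) + (d + q) →
  nth (interval k0 d ++ interval (suc k0 + d) (q + q) ++ interval (suc (suc k0 + d + (q + q))) d) (v ∸ 1)
    ≡ relabelA k0 d q v
nth-relabelA k0 d q (suc u) _ v≤ with <-or-offset u d
... | inj₁ u<d = begin
  nth (interval k0 d ++ _) u      ≡⟨ nth-++ˡ (interval k0 d) _ (subst (u <_) (sym (length-interval k0 d)) u<d) ⟩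
  nth (interval k0 d) u           ≡⟨ nth-interval k0 d u u<d ⟩
  suc (k0 + u)                    ≡⟨ arith k0 u ⟩
  k0 + suc u + 0 + 0
    ≡⟨ sym (cong₂ (λ x y → k0 + suc u + x + y) (jump-≤ u<d) (jump-≤ (≤-trans u<d (m≤m+n d (q + q))))) ⟩
  relabelA k0 d q (suc u)         ∎
  where
  open ≡-Reasoning
  arith : ∀ k0 u → suc (k0 + u) ≡ k0 + suc u + 0 + 0
  arith = solve-∀
... | inj₂ (u' , refl) with <-or-offset u' (q + q)
...   | inj₁ u'<2q = begin
  nth (interval k0 d ++ rest) (d + u')
    ≡⟨ cong (λ x → nth (interval k0 d ++ rest) (x + u')) (sym (length-interval k0 d)) ⟩
  nth (interval k0 d ++ rest) (length (interval k0 d) + u')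
    ≡⟨ nth-++ʳ (interval k0 d) rest u' ⟩
  nth (interval (suc k0 + d) (q + q) ++ _) u'
    ≡⟨ nth-++ˡ (interval (suc k0 + d) (q + q)) _ (subst (u' <_) (sym (length-interval _ (q + q))) u'<2q) ⟩
  nth (interval (suc k0 + d) (q + q)) u'
    ≡⟨ nth-interval _ (q + q) u' u'<2q ⟩
  suc (suc k0 + d + u')
    ≡⟨ arith k0 d u' ⟩
  k0 + suc (d + u') + 1 + 0
    ≡⟨ sym (cong₂ (λ x y → k0 + suc (d + u') + x + y) (jump-> (s≤s (m≤m+n d u')))
                  (jump-≤ (+-monoʳ-< d u'<2q))) ⟩
  relabelA k0 d q (suc (d + u')) ∎
  where
  open ≡-Reasoning
  rest : List ℕ
  rest = interval (suc k0 + d) (q + q) ++ interval (suc (suc k0 + d + (q + q))) d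
  arith : ∀ k0 d u' → suc (suc k0 + d + u') ≡ k0 + suc (d + u') + 1 + 0
  arith = solve-∀
...   | inj₂ (u'' , refl) = begin
  nth (interval k0 d ++ rest) (d + (q + q + u''))
    ≡⟨ cong (λ x → nth (interval k0 d ++ rest) (x + (q + q + u''))) (sym (length-interval k0 d)) ⟩
  nth (interval k0 d ++ rest) (length (interval k0 d) + (q + q + u''))
    ≡⟨ nth-++ʳ (interval k0 d) rest (q + q + u'') ⟩
  nth (interval (suc k0 + d) (q + q) ++ third) (q + q + u'')
    ≡⟨ cong (λ x → nth (interval (suc k0 + d) (q + q) ++ third) (x + u'')) (sym (length-interval _ (q + q))) ⟩
  nth (interval (suc k0 + d) (q + q) ++ third) (length (interval (suc k0 + d) (q + q)) + u'')
    ≡⟨ nth-++ʳ (interval (suc k0 + d) (q + q)) third u'' ⟩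
  nth third u''
    ≡⟨ nth-interval _ d u'' u''<d ⟩
  suc (suc (suc k0 + d + (q + q)) + u'')
    ≡⟨ arith k0 d q u'' ⟩
  k0 + suc (d + (q + q + u'')) + 1 + 1
    ≡⟨ sym (cong₂ (λ x y → k0 + suc (d + (q + q + u'')) + x + y) (jump-> (s≤s (m≤m+n d _)))
                  (jump-> (s≤s (subst (d + (q + q) ≤_) (+-assoc d (q + q) u'') (m≤m+n _ u''))))) ⟩
  relabelA k0 d q (suc (d + (q + q + u''))) ∎
  where
  open ≡-Reasoning
  third rest : List ℕ
  third = interval (suc (suc k0 + d + (q + q))) d
  rest  = interval (suc k0 + d) (q + q) ++ third
  arith : ∀ k0 d q u'' → suc (suc (suc k0 + d + (q + q)) + u'') ≡ k0 + suc (d + (q + q + u'')) + 1 + 1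
  arith = solve-∀
  u''<d : u'' < d
  u''<d = +-cancelˡ-≤ (d + (q + q)) (suc u'') d (subst₂ _≤_ (arith₁ d q u'') (arith₂ d q) v≤)
    where
    arith₁ : ∀ d q u'' → suc (d + (q + q + u'')) ≡ d + (q + q) + suc u''
    arith₁ = solve-∀
    arith₂ : ∀ d q → (d + q) + (d + q) ≡ d + (q + q) + d
    arith₂ = solve-∀

reverse-caseA : ∀ k0 d q ψ → All (λ v → 1 ≤ v × v ≤ (d + q) + (d + q)) (reverse ψ) →
  reverse (PsiCases.caseA (suc k0 + d) (suc k0) (suc k0 + d + q) ψ)
    ≡ frame (suc (k0 + d)) k0 (relabelA k0 d q) (reverse ψ) ((d + q) + (d + q)) (suc (suc (k0 + d + (q + q))))
reverse-caseA k0 d q ψ bounded =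
  trans (reverse-shape (suc m ∸ (suc k0 + d)) descending E (reverse (range1 k0)) (suc k0 + d))
        (cong (suc k0 + d ∷_) (cong₂ _++_ (reverse-reverse-range1 k0)
          (cong₂ _++_ reverse-E (cong₂ (λ xs x → xs ++ x ∷ []) reverse-descending′ (ComplementA.T3≡ k0 d q)))))
  where
  open PsiCases (suc k0 + d) (suc k0) (suc k0 + d + q)
  descending : List ℕ
  descending = map (λ i → (m + 2) ∸ i) (map (2 +_) (upTo k0))
  E : List ℕ
  E = embed (complementIn m (ComplementA.removed k0 d q)) ψ
  reverse-E : reverse E ≡ map (relabelA k0 d q) (reverse ψ)
  reverse-E = reverse-embed (complementIn m (ComplementA.removed k0 d q)) ψ (relabelA k0 d q) _ bounded (λ v 1≤v v≤ →
    trans (cong (λ S → nth S (v ∸ 1)) (ComplementA.complement k0 d q)) (nth-relabelA k0 d q v 1≤v v≤))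
  reverse-descending′ : reverse descending ≡ interval (suc (suc k0 + ((d + q) + (d + q)))) k0
  reverse-descending′ = reverse-descending m _ k0 (arith k0 d q)
    where
    arith : ∀ k0 d q → 2 * (suc k0 + d + q) ≡ suc (suc k0 + ((d + q) + (d + q))) + k0
    arith = solve-∀

-- Runs, Dyck prefixes and returns

leadU-runs : ∀ s → s ≡ replicate (proj₁ (leadU s)) U ++ proj₂ (leadU s)
leadU-runs []      = refl
leadU-runs (U ∷ s) = cong (U ∷_) (leadU-runs s)
leadU-runs (D ∷ s) = refl

leadD-runs : ∀ s → s ≡ replicate (proj₁ (leadD s)) D ++ proj₂ (leadD s)
leadD-runs []      = refl
leadD-runs (D ∷ s) = cong (D ∷_) (leadD-runs s)
leadD-runs (U ∷ s) = refl

leadU-rest-≢U : ∀ s {s'} → proj₂ (leadU s) ≢ U ∷ s'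
leadU-rest-≢U []      ()
leadU-rest-≢U (U ∷ s) eq = leadU-rest-≢U s eq
leadU-rest-≢U (D ∷ s) ()

leadD-empty : ∀ s → proj₁ (leadD s) ≡ 0 → (∀ {s'} → s ≢ U ∷ s') → proj₂ (leadD s) ≡ []
leadD-empty []      _  _   = refl
leadD-empty (U ∷ s) _  ≢U = ⊥-elim (≢U refl)
leadD-empty (D ∷ s) () _

leadU-replicate : ∀ j s → proj₁ (leadU (replicate j U ++ D ∷ s)) ≡ j
leadU-replicate zero    s = refl
leadU-replicate (suc j) s = cong suc (leadU-replicate j s)

leadU-replicate-≥ : ∀ d s → d ≤ proj₁ (leadU (replicate d U ++ s))
leadU-replicate-≥ zero    s = z≤n
leadU-replicate-≥ (suc d) s = s≤s (leadU-replicate-≥ d s)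

length-runs : ∀ j k (π' : List Step) → length (replicate j U ++ replicate k D ++ π') ≡ j + (k + length π')
length-runs j k π' = trans (length-++ (replicate j U))
  (cong₂ _+_ (length-replicate j) (trans (length-++ (replicate k D)) (cong (_+ length π') (length-replicate k))))

⌊n+n/2⌋≡n : ∀ n → ⌊ n + n /2⌋ ≡ n
⌊n+n/2⌋≡n zero    = refl
⌊n+n/2⌋≡n (suc n) rewrite +-suc n n = cong suc (⌊n+n/2⌋≡n n)

DP-ups : ∀ j {h s e} → DP h (replicate j U ++ s) e → DP (j + h) s e
DP-ups zero    p = p
DP-ups (suc j) {h} {s} {e} (up p) = subst (λ x → DP x s e) (+-suc j h) (DP-ups j p)

DP-ups⁻ : ∀ j {h s e} → DP (j + h) s e → DP h (replicate j U ++ s) e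
DP-ups⁻ zero    p = p
DP-ups⁻ (suc j) {h} {s} {e} p = up (DP-ups⁻ j (subst (λ x → DP x s e) (sym (+-suc j h)) p))

DP-downs : ∀ k {h s e} → DP h (replicate k D ++ s) e → ∃[ h' ] (h ≡ k + h' × DP h' s e)
DP-downs zero    {h} p = h , refl , p
DP-downs (suc k) (down p) with DP-downs k p
... | h' , refl , q = h' , refl , q

DP-lower : ∀ t {h H s e} → H ≡ t + h → DP H s e → length s ≤ h → ∃[ e' ] (e ≡ t + e' × DP h s e')
DP-lower t {h} {s = []}    H≡ done _ = h , H≡ , done
DP-lower t {h} {s = U ∷ s} H≡ (up p) len≤
  with DP-lower t (trans (cong suc H≡) (sym (+-suc t h))) p (≤-trans (n≤1+n _) (≤-trans len≤ (n≤1+n h)))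
... | e' , e≡ , q = e' , e≡ , up q
DP-lower t {suc h} {s = D ∷ s} H≡ (down p) (s≤s len≤) with DP-lower t (suc-injective (trans H≡ (+-suc t h))) p len≤
... | e' , e≡ , q = e' , e≡ , down q

DP-unique : ∀ {h s e e'} → DP h s e → DP h s e' → e ≡ e'
DP-unique done     done     = refl
DP-unique (up p)   (up q)   = DP-unique p q
DP-unique (down p) (down q) = DP-unique p q

retFrom-ups : ∀ j h s → retFrom h (replicate j U ++ s) ≡ retFrom (j + h) s
retFrom-ups zero    h s = refl
retFrom-ups (suc j) h s = trans (retFrom-ups j (suc h) s) (cong (λ x → retFrom x s) (+-suc j h))

retFrom-downs : ∀ k h s → retFrom (k + suc h) (replicate k D ++ s) ≡ retFrom (suc h) s
retFrom-downs zero    h s = refl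
retFrom-downs (suc k) h s rewrite +-suc k h =
  trans (cong (λ x → retFrom x (replicate k D ++ s)) (sym (+-suc k h))) (retFrom-downs k h s)

retFrom-downs-to-0 : ∀ k s → retFrom (suc k) (replicate (suc k) D ++ s) ≡ suc (ret s)
retFrom-downs-to-0 zero    s = refl
retFrom-downs-to-0 (suc k) s = retFrom-downs-to-0 k s

retFrom-high : ∀ h s → length s < h → retFrom h s ≡ 0
retFrom-high h             []      _          = refl
retFrom-high h             (U ∷ s) len<       = retFrom-high (suc h) s (≤-trans (n≤1+n _) (≤-trans len< (n≤1+n h)))
retFrom-high (suc (suc h)) (D ∷ s) (s≤s len<) = retFrom-high (suc h) s len<
retFrom-high (suc zero)    (D ∷ s) (s≤s ())

ret-peak-to-0 : ∀ k π' → ret (replicate (suc k) U ++ replicate (suc k) D ++ π') ≡ suc (ret π')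
ret-peak-to-0 k π' = trans (retFrom-ups (suc k) 0 _)
  (trans (cong (λ x → retFrom x (replicate (suc k) D ++ π')) (+-identityʳ (suc k))) (retFrom-downs-to-0 k π'))

ret-peak-above-0 : ∀ k d π' → ret (replicate (k + suc d) U ++ replicate k D ++ π') ≡ ret (replicate (suc d) U ++ π')
ret-peak-above-0 k d π' = begin
  ret (replicate (k + suc d) U ++ replicate k D ++ π') ≡⟨ retFrom-ups (k + suc d) 0 _ ⟩
  retFrom (k + suc d + 0) (replicate k D ++ π')       ≡⟨ cong (λ x → retFrom x (replicate k D ++ π')) (+-identityʳ _) ⟩
  retFrom (k + suc d) (replicate k D ++ π')           ≡⟨ retFrom-downs k d π' ⟩
  retFrom (suc d) π'                                  ≡⟨ cong (λ x → retFrom x π') (sym (+-identityʳ (suc d))) ⟩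
  retFrom (suc d + 0) π'                              ≡⟨ sym (retFrom-ups (suc d) 0 π') ⟩
  ret (replicate (suc d) U ++ π')                     ∎
  where open ≡-Reasoning

record PsiInvariant (n : ℕ) (π : List Step) (e : ℕ) (τ : List ℕ) : Set where
  field
    cutInvariant : CutInvariant (n + n) τ
    head≥        : proj₁ (leadU π) ⊓ suc n ≤ prefixMax τ 1
    cuts         : count (isCut τ) 0 (n + n) ≡ ret π + ret π + 1 ⊓ e

InvariantBelow : ℕ → Set
InvariantBelow f =
  ∀ n π e → length π ≡ n + n → length π ≤ f → DP 0 π e → PsiInvariant n π e (reverse (psi f π))

invariant-case-a : ∀ f → InvariantBelow f → ∀ {j k n π} k0 d q π' e →
  j ≡ suc k0 + d → k ≡ suc k0 → n ≡ suc k0 + d + q → π ≡ replicate j U ++ replicate k D ++ π' →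
  length π' ≡ d + (q + q) → DP d π' e → length π ≤ suc f →
  PsiInvariant n π e (reverse (PsiCases.caseA j k n (psi f (replicate (j ∸ k) U ++ π'))))
invariant-case-a f IH k0 d q π' e refl refl refl refl len-π' dp fuel
  rewrite m+n∸m≡n (suc k0) d = subst (PsiInvariant n π e) (sym (reverse-caseA k0 d q ψ W.bounded)) record
    { cutInvariant = A.invariant
    ; head≥        = ≤-trans (m⊓n≤m _ _) (≤-reflexive (trans (leadU-replicate (suc k0 + d) _) (sym A.prefixMax-1)))
    ; cuts         = cuts
    }
  where
  π inner : List Step
  π     = replicate (suc k0 + d) U ++ replicate (suc k0) D ++ π'
  inner = replicate d U ++ π'
  n : ℕ
  n = suc k0 + d + q
  ψ : List ℕ
  ψ = psi f inner
  length-inner : length inner ≡ (d + q) + (d + q)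
  length-inner = trans (length-++ (replicate d U)) (trans (cong₂ _+_ (length-replicate d) len-π') (arith d q))
    where
    arith : ∀ d q → d + (d + (q + q)) ≡ (d + q) + (d + q)
    arith = solve-∀
  fuel-inner : length inner ≤ f
  fuel-inner = ≤-pred (≤-trans (≤-trans (s≤s (≤-reflexive length-inner)) (m+d≡n⇒m≤n (suc (k0 + k0)) (arith k0 d q))) fuel′)
    where
    arith : ∀ k0 d q → suc ((d + q) + (d + q)) + suc (k0 + k0) ≡ suc k0 + d + (suc k0 + (d + (q + q)))
    arith = solve-∀
    fuel′ : suc k0 + d + (suc k0 + (d + (q + q))) ≤ suc f
    fuel′ = subst (_≤ suc f)
              (trans (length-runs (suc k0 + d) (suc k0) π') (cong (λ x → suc k0 + d + (suc k0 + x)) len-π')) fuel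
  I : PsiInvariant (d + q) inner e (reverse ψ)
  I = IH (d + q) inner e length-inner fuel-inner (DP-ups⁻ d (subst (λ x → DP x π' e) (sym (+-identityʳ d)) dp))
  module I = PsiInvariant I
  module W = CutInvariant I.cutInvariant
  d≤head : d ≤ prefixMax (reverse ψ) 1
  d≤head = ≤-trans (⊓-glb (leadU-replicate-≥ d π') (≤-trans (m≤m+n d q) (n≤1+n _))) I.head≥
  module A = CaseA k0 d q (reverse ψ) I.cutInvariant d≤head
  ret-flat : d ≡ 0 → ret π ≡ suc (ret inner)
  ret-flat refl =
    trans (cong (λ x → ret (replicate x U ++ replicate (suc k0) D ++ π')) (+-identityʳ (suc k0))) (ret-peak-to-0 k0 π')
  ret-raised : ∀ {d'} → suc d' ≡ d → ret π ≡ ret inner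
  ret-raised {d'} refl = ret-peak-above-0 (suc k0) d' π'
  cuts : count (isCut A.τ) 0 (n + n) ≡ ret π + ret π + 1 ⊓ e
  cuts with d ≤? 0
  ... | yes d≤0 = begin
    count (isCut A.τ) 0 (n + n)               ≡⟨ A.count-cuts-flat (n≤0⇒n≡0 d≤0) ⟩
    2 + count (isCut (reverse ψ)) 0 A.l       ≡⟨ cong (2 +_) I.cuts ⟩
    2 + (ret inner + ret inner + 1 ⊓ e)       ≡⟨ arith (ret inner) (1 ⊓ e) ⟩
    suc (ret inner) + suc (ret inner) + 1 ⊓ e ≡⟨ cong (λ x → x + x + 1 ⊓ e) (sym (ret-flat (n≤0⇒n≡0 d≤0))) ⟩
    ret π + ret π + 1 ⊓ e                     ∎
    where
    open ≡-Reasoning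
    arith : ∀ x y → 2 + (x + x + y) ≡ suc x + suc x + y
    arith = solve-∀
  ... | no d≰0 = begin
    count (isCut A.τ) 0 (n + n)               ≡⟨ A.count-cuts-raised (≰⇒> d≰0) ⟩
    count (isCut (reverse ψ)) 0 A.l           ≡⟨ I.cuts ⟩
    ret inner + ret inner + 1 ⊓ e
      ≡⟨ cong (λ x → x + x + 1 ⊓ e) (sym (ret-raised (suc-pred d ⦃ >-nonZero (≰⇒> d≰0) ⦄))) ⟩
    ret π + ret π + 1 ⊓ e                     ∎
    where open ≡-Reasoning

invariant-case-b : ∀ f → InvariantBelow f → ∀ {j n π} k r π' e →
  j ≡ suc (suc (k + r)) → n ≡ suc (k + r) → π ≡ replicate j U ++ replicate k D ++ π' →
  length π' ≡ r → DP (suc (suc r)) π' e → length π ≤ suc f →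
  PsiInvariant n π e (reverse (PsiCases.caseB j k n (psi f (replicate (n ∸ k ∸ 1) U ++ π'))))
invariant-case-b f IH k r π' e refl refl refl len-π' dp fuel =
  subst (λ x → PsiInvariant (suc (k + r)) π e (reverse (caseB (psi f (replicate x U ++ π'))))) (sym runs≡)
  (subst (PsiInvariant (suc (k + r)) π e) (sym (reverse-caseB (suc (suc (k + r))) k r ψ W.bounded)) record
    { cutInvariant = B.invariant
    ; head≥        = m⊓n≤n _ _
    ; cuts         = begin
        count (isCut B.τ) 0 (suc (k + r) + suc (k + r)) ≡⟨ B.count-cuts ⟩
        1                                               ≡⟨ cong₂ (λ x y → x + x + y) (sym ret≡0) (sym (m≤n⇒m⊓n≡m 1≤e)) ⟩
        ret π + ret π + 1 ⊓ e                           ∎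
    })
  where
  open ≡-Reasoning
  open PsiCases (suc (suc (k + r))) k (suc (k + r)) using (caseB)
  runs≡ : suc (k + r) ∸ k ∸ 1 ≡ r
  runs≡ = cong (_∸ 1) (trans (cong (_∸ k) (sym (+-suc k r))) (m+n∸m≡n k (suc r)))
  π inner : List Step
  π     = replicate (suc (suc (k + r))) U ++ replicate k D ++ π'
  inner = replicate r U ++ π'
  ψ : List ℕ
  ψ = psi f inner
  lowered : ∃[ e' ] (e ≡ 2 + e' × DP r π' e')
  lowered = DP-lower 2 refl dp (≤-reflexive len-π')
  1≤e : 1 ≤ e
  1≤e = subst (1 ≤_) (sym (proj₁ (proj₂ lowered))) (s≤s z≤n)
  length-inner : length inner ≡ r + r
  length-inner = trans (length-++ (replicate r U)) (cong₂ _+_ (length-replicate r) len-π')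
  fuel-inner : length inner ≤ f
  fuel-inner = ≤-pred (≤-trans (≤-trans (s≤s (≤-reflexive length-inner)) (m+d≡n⇒m≤n (suc (k + k)) (arith k r))) fuel′)
    where
    arith : ∀ k r → suc (r + r) + suc (k + k) ≡ suc (suc (k + r)) + (k + r)
    arith = solve-∀
    fuel′ : suc (suc (k + r)) + (k + r) ≤ suc f
    fuel′ = subst (_≤ suc f)
              (trans (length-runs (suc (suc (k + r))) k π') (cong (λ x → suc (suc (k + r)) + (k + x)) len-π')) fuel
  I : PsiInvariant r inner (proj₁ lowered) (reverse ψ)
  I = IH r inner (proj₁ lowered) length-inner fuel-inner
         (DP-ups⁻ r (subst (λ x → DP x π' (proj₁ lowered)) (sym (+-identityʳ r)) (proj₂ (proj₂ lowered))))
  module W = CutInvariant (PsiInvariant.cutInvariant I)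
  module B = CaseB k r (reverse ψ) (PsiInvariant.cutInvariant I)
  ret≡0 : ret π ≡ 0
  ret≡0 = begin
    ret π                                           ≡⟨ retFrom-ups (suc (suc (k + r))) 0 _ ⟩
    retFrom (suc (suc (k + r)) + 0) (replicate k D ++ π') ≡⟨ cong (λ x → retFrom x (replicate k D ++ π')) (arith k r) ⟩
    retFrom (k + suc (suc r)) (replicate k D ++ π') ≡⟨ retFrom-downs k (suc r) π' ⟩
    retFrom (suc (suc r)) π'                        ≡⟨ retFrom-high (suc (suc r)) π' (s≤s (≤-trans (≤-reflexive len-π') (n≤1+n r))) ⟩
    0                                               ∎
    where
    arith : ∀ k r → suc (suc (k + r)) + 0 ≡ k + suc (suc r)
    arith = solve-∀

invariant-case-c : ∀ f → InvariantBelow f → ∀ {j n π} j2 k r π' e →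
  j ≡ suc (suc j2) → n ≡ suc r → π ≡ replicate j U ++ replicate k D ++ π' →
  suc r ≤ j2 → suc (suc j2) + (k + length π') ≡ suc r + suc r → DP (suc (suc j2)) (replicate k D ++ π') e →
  length π ≤ suc f →
  PsiInvariant n π e (reverse (PsiCases.caseC j k n (psi f (replicate (j ∸ 2) U ++ replicate k D ++ π'))))
invariant-case-c f IH j2 k r π' e refl refl refl r<j2 len dp fuel =
  subst (PsiInvariant (suc r) π e) (sym (reverse-caseC (suc (suc j2)) k r ψ W.bounded)) record
    { cutInvariant = C.invariant
    ; head≥        = m⊓n≤n _ _
    ; cuts         = begin
        count (isCut C.τ) 0 (suc r + suc r) ≡⟨ C.count-cuts ⟩
        1                                   ≡⟨ cong₂ (λ x y → x + x + y) (sym ret≡0) (sym (m≤n⇒m⊓n≡m 1≤e)) ⟩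
        ret π + ret π + 1 ⊓ e               ∎
    }
  where
  open ≡-Reasoning
  π inner : List Step
  π     = replicate (suc (suc j2)) U ++ replicate k D ++ π'
  inner = replicate j2 U ++ replicate k D ++ π'
  ψ : List ℕ
  ψ = psi f inner
  tail≤j2 : length (replicate k D ++ π') ≤ j2
  tail≤j2 = subst (_≤ j2) (sym (trans (length-++ (replicate k D)) (cong (_+ length π') (length-replicate k))))
    (+-cancelˡ-≤ (suc (suc j2)) _ j2
      (≤-trans (≤-reflexive len) (≤-trans (+-mono-≤ r<j2 r<j2) (m+d≡n⇒m≤n 2 (arith j2)))))
    where
    arith : ∀ j2 → j2 + j2 + 2 ≡ suc (suc j2) + j2
    arith = solve-∀
  lowered : ∃[ e' ] (e ≡ 2 + e' × DP j2 (replicate k D ++ π') e')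
  lowered = DP-lower 2 refl dp tail≤j2
  1≤e : 1 ≤ e
  1≤e = subst (1 ≤_) (sym (proj₁ (proj₂ lowered))) (s≤s z≤n)
  length-inner : length inner ≡ r + r
  length-inner = +-cancelˡ-≡ 2 _ _ (trans (cong (2 +_) (length-runs j2 k π')) (trans len (arith r)))
    where
    arith : ∀ r → suc r + suc r ≡ 2 + (r + r)
    arith = solve-∀
  fuel-inner : length inner ≤ f
  fuel-inner = ≤-pred (≤-trans (s≤s (≤-trans (≤-reflexive (length-runs j2 k π')) (n≤1+n _)))
                               (subst (_≤ suc f) (length-runs (suc (suc j2)) k π') fuel))
  I : PsiInvariant r inner (proj₁ lowered) (reverse ψ)
  I = IH r inner (proj₁ lowered) length-inner fuel-inner
         (DP-ups⁻ j2 (subst (λ x → DP x (replicate k D ++ π') (proj₁ lowered)) (sym (+-identityʳ j2))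
                            (proj₂ (proj₂ lowered))))
  module W = CutInvariant (PsiInvariant.cutInvariant I)
  module C = CaseB 0 r (reverse ψ) (PsiInvariant.cutInvariant I)
  ret≡0 : ret π ≡ 0
  ret≡0 = trans (retFrom-ups (suc (suc j2)) 0 _)
    (retFrom-high (suc (suc j2) + 0) (replicate k D ++ π')
      (≤-trans (s≤s (≤-trans tail≤j2 (n≤1+n j2))) (≤-reflexive (sym (+-identityʳ _)))))

empty-invariant : PsiInvariant 0 [] 0 []
empty-invariant = record
  { cutInvariant = record
    { length≡    = refl
    ; bounded    = []
    ; ≤prefixMax = λ m 1≤m m≤0 → ⊥-elim (<⇒≱ 1≤m m≤0)
    ; cut+head≤  = λ _ _ m<0 _ → ⊥-elim (n≮0 m<0)
    }
  ; head≥        = z≤n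
  ; cuts         = refl
  }

module InvariantStep (f n : ℕ) (ss : List Step) (e : ℕ) (len≡ : length (U ∷ ss) ≡ n + n)
                     (fuel : length (U ∷ ss) ≤ suc f) (dp : DP 0 (U ∷ ss) e) (IH : InvariantBelow f) where

  π rest π' : List Step
  π    = U ∷ ss
  rest = proj₂ (leadU π)
  π'   = proj₂ (leadD rest)
  j k : ℕ
  j = proj₁ (leadU π)
  k = proj₁ (leadD rest)
  open PsiCases j k n using (step; step-caseA; step-caseB; step-caseC)

  π≡ : π ≡ replicate j U ++ replicate k D ++ π'
  π≡ = trans (leadU-runs π) (cong (replicate j U ++_) (leadD-runs rest))

  unfolded : psi (suc f) π ≡ step f π'
  unfolded = trans (psi-unfold f U ss refl refl)
                   (cong (λ x → PsiCases.step j k x f π') (trans (cong ⌊_/2⌋ len≡) (⌊n+n/2⌋≡n n)))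

  length≡ : j + (k + length π') ≡ n + n
  length≡ = trans (sym (length-runs j k π')) (trans (cong length (sym π≡)) len≡)

  1≤n : 1 ≤ n
  1≤n with n ≤? 0
  ... | yes n≤0 = ⊥-elim (1+n≢0 (trans len≡ (cong (λ x → x + x) (n≤0⇒n≡0 n≤0))))
  ... | no  n≰0 = ≰⇒> n≰0

  dp-j : DP j (replicate k D ++ π') e
  dp-j = subst (λ x → DP x (replicate k D ++ π') e) (+-identityʳ j) (DP-ups j (subst (λ x → DP 0 x e) π≡ dp))

  h' : ℕ
  h' = proj₁ (DP-downs k dp-j)
  j≡k+h' : j ≡ k + h'
  j≡k+h' = proj₁ (proj₂ (DP-downs k dp-j))
  dp' : DP h' π' e
  dp' = proj₂ (proj₂ (DP-downs k dp-j))

  case-a : j ≤ n → PsiInvariant n π e (reverse (PsiCases.caseA j k n (psi f (replicate (j ∸ k) U ++ π'))))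
  case-a j≤n = invariant-case-a f IH k0 h' q π' e j≡ k≡ n≡ π≡ length-π' dp' fuel
    where
    1≤k : 1 ≤ k
    1≤k with k ≤? 0
    ... | no k≰0 = ≰⇒> k≰0
    ... | yes k≤0 =
      ⊥-elim (<⇒≱ 1≤n (+-cancelˡ-≤ n n 0 (subst (_≤ n + 0) j≡n+n (subst (j ≤_) (sym (+-identityʳ n)) j≤n))))
      where
      π'≡[] : π' ≡ []
      π'≡[] = leadD-empty rest (n≤0⇒n≡0 k≤0) (leadU-rest-≢U π)
      j≡n+n : j ≡ n + n
      j≡n+n = trans (sym (trans (cong₂ (λ x y → j + (x + length y)) (n≤0⇒n≡0 k≤0) π'≡[]) (+-identityʳ j))) length≡
    k0 q : ℕ
    k0 = pred k
    q  = n ∸ j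
    k≡ : k ≡ suc k0
    k≡ = sym (suc-pred k ⦃ >-nonZero 1≤k ⦄)
    j≡ : j ≡ suc k0 + h'
    j≡ = trans j≡k+h' (cong (_+ h') k≡)
    n≡ : n ≡ suc k0 + h' + q
    n≡ = trans (sym (m+[n∸m]≡n j≤n)) (cong (_+ q) j≡)
    length-π' : length π' ≡ h' + (q + q)
    length-π' = +-cancelˡ-≡ (suc k0 + h' + suc k0) _ _ (begin
      suc k0 + h' + suc k0 + length π'      ≡⟨ arith₁ (suc k0) h' (length π') ⟩
      suc k0 + h' + (suc k0 + length π')    ≡⟨ cong₂ (λ x y → x + (y + length π')) (sym j≡) (sym k≡) ⟩
      j + (k + length π')                   ≡⟨ length≡ ⟩
      n + n                                 ≡⟨ cong (λ x → x + x) n≡ ⟩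
      (suc k0 + h' + q) + (suc k0 + h' + q) ≡⟨ arith₂ (suc k0) h' q ⟩
      suc k0 + h' + suc k0 + (h' + (q + q)) ∎)
      where
      open ≡-Reasoning
      arith₁ : ∀ a b c → a + b + a + c ≡ (a + b) + (a + c)
      arith₁ = solve-∀
      arith₂ : ∀ a b c → (a + b + c) + (a + b + c) ≡ a + b + a + (b + (c + c))
      arith₂ = solve-∀

  case-b : j ≡ suc n → PsiInvariant n π e (reverse (PsiCases.caseB j k n (psi f (replicate (n ∸ k ∸ 1) U ++ π'))))
  case-b j≡ = invariant-case-b f IH k (length π') π' e (trans j≡ (cong suc n≡)) n≡ π≡ refl
                               (subst (λ x → DP x π' e) h'≡ dp') fuel
    where
    n≡ : n ≡ suc (k + length π')
    n≡ = +-cancelˡ-≡ n _ _ (trans (sym length≡) (trans (cong (_+ (k + length π')) j≡) (sym (+-suc n _))))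
    h'≡ : h' ≡ suc (suc (length π'))
    h'≡ = +-cancelˡ-≡ k _ _ (trans (sym j≡k+h') (trans j≡ (trans (cong suc n≡) (arith k (length π')))))
      where
      arith : ∀ k l → suc (suc (k + l)) ≡ k + suc (suc l)
      arith = solve-∀

  case-c : suc n < j →
           PsiInvariant n π e (reverse (PsiCases.caseC j k n (psi f (replicate (j ∸ 2) U ++ replicate k D ++ π'))))
  case-c sn<j = invariant-case-c f IH j2 k r π' e j≡ n≡ π≡ r<j2
    (trans (cong (_+ (k + length π')) (sym j≡)) (trans length≡ (cong (λ x → x + x) n≡)))
    (subst (λ x → DP x (replicate k D ++ π') e) j≡ dp-j) fuel
    where
    j2 r : ℕ
    j2 = j ∸ 2
    r  = pred n
    j≡ : j ≡ suc (suc j2)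
    j≡ = sym (m+[n∸m]≡n (≤-trans (s≤s (s≤s z≤n)) sn<j))
    n≡ : n ≡ suc r
    n≡ = sym (suc-pred n ⦃ >-nonZero 1≤n ⦄)
    r<j2 : suc r ≤ j2
    r<j2 = subst (_≤ j2) n≡ (≤-pred (≤-pred (subst (suc (suc n) ≤_) j≡ sn<j)))

  by-case : PsiInvariant n π e (reverse (step f π'))
  by-case with j ≤? n | j ≟ suc n
  ... | yes j≤n | _      = subst (λ ψ → PsiInvariant n π e (reverse ψ)) (sym (step-caseA {f} {π'} j≤n)) (case-a j≤n)
  ... | no  _   | yes j≡ = subst (λ ψ → PsiInvariant n π e (reverse ψ)) (sym (step-caseB {f} {π'} j≡)) (case-b j≡)
  ... | no  j≰n | no j≢  = subst (λ ψ → PsiInvariant n π e (reverse ψ)) (sym (step-caseC {f} {π'} sn<j)) (case-c sn<j)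
    where
    sn<j : suc n < j
    sn<j = ≤∧≢⇒< (≰⇒> j≰n) (j≢ ∘ sym)

  invariant : PsiInvariant n π e (reverse (psi (suc f) π))
  invariant = subst (λ ψ → PsiInvariant n π e (reverse ψ)) (sym unfolded) by-case

psi-invariant : ∀ f → InvariantBelow f
psi-invariant zero    zero    []       _ _    _    done = empty-invariant
psi-invariant (suc f) zero    []       _ _    _    done = empty-invariant
psi-invariant f       (suc n) []       _ ()   _    _
psi-invariant zero    n       (_ ∷ _)  _ _    ()   _
psi-invariant (suc f) n       (D ∷ _)  _ _    _    ()
psi-invariant (suc f) n       (U ∷ ss) e len≡ fuel dp =
  InvariantStep.invariant f n ss e len≡ fuel dp (psi-invariant f)

rightComponents-Ψ : ∀ n π e → length π ≡ n + n → DP 0 π e → rightComponents (Ψ π) ≡ ret π + ret π + 1 ⊓ e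
rightComponents-Ψ n π e len dp = begin
  components τ                  ≡⟨ components≡count-isCut τ ⟩
  count (isCut τ) 0 (length τ) ≡⟨ cong (count (isCut τ) 0) (CutInvariant.length≡ I.cutInvariant) ⟩
  count (isCut τ) 0 (n + n)    ≡⟨ I.cuts ⟩
  ret π + ret π + 1 ⊓ e        ∎
  where
  open ≡-Reasoning
  τ : List ℕ
  τ = reverse (Ψ π)
  module I = PsiInvariant (psi-invariant (length π) n π e len ≤-refl dp)

theorem9 : (n : ℕ) → 0 < n → (σ : List ℕ) → InC123 (2 * n) σ →
    (π : List Step) → DyckPrefix π → length π ≡ 2 * n → Ψ π ≡ σ →
    (DyckPath π → rightComponents σ ≡ 2 * ret π)
    × (¬ DyckPath π → rightComponents σ ≡ 2 * ret π + 1)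
theorem9 n _ σ _ π (e , dp) len refl = dyck , not-dyck
  where
  components≡ : rightComponents (Ψ π) ≡ ret π + ret π + 1 ⊓ e
  components≡ = rightComponents-Ψ n π e (trans len (cong (n +_) (+-identityʳ n))) dp
  double : ∀ x → x + x ≡ 2 * x
  double x = cong (x +_) (sym (+-identityʳ x))
  dyck : DyckPath π → rightComponents (Ψ π) ≡ 2 * ret π
  dyck dyck-π = trans components≡ (trans (cong (ret π + ret π +_) (cong (1 ⊓_) (DP-unique dp dyck-π)))
                                         (trans (+-identityʳ _) (double (ret π))))
  not-dyck : ¬ DyckPath π → rightComponents (Ψ π) ≡ 2 * ret π + 1
  not-dyck ¬dyck = trans components≡ (cong₂ _+_ (double (ret π))
                     (m≤n⇒m⊓n≡m (n≢0⇒n>0 (λ e≡0 → ¬dyck (subst (DP 0 π) e≡0 dp)))))
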